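{- For integers $n\geq 2$ and $1\leq s\leq n$, $$\widehat{A}(n+1,s)=\frac{1}{2^{n}}\sum_{k=0}^{\lfloor (n+1)/2\rfloor}(n-2k+1)\,p(n,n-2k+1)\,E(n,k,s).$$
   Context: Let $\mathfrak{S}_m$ be the symmetric group on $\{1,\dots,m\}$. For $\pi\in\mathfrak{S}_m$, ${\rm altdes}(\pi)=|\{2i: \pi(2i)<\pi(2i+1)\}\cup\{2i+1:\pi(2i+1)>\pi(2i+2)\}|$ (positions among $1,\dots,m-1$). The alternating Eulerian numbers $\widehat{A}(m,k)$ are defined by $\sum_{\pi\in\mathfrak{S}_m}x^{{\rm altdes}(\pi)}=\sum_{k=0}^{m-1}\widehat{A}(m,k)x^k$, i.e. $\widehat{A}(m,k)$ is the number of $\pi\in\mathfrak{S}_m$ with $k$ alternating descents. The derivative polynomials are defined by $P_0(x)=x$, $P_{n+1}(x)=(1+x^2)P_n'(x)$ (equivalently $P_n(\tan\theta)=\frac{d^n}{d\theta^n}\tan\theta$), and $p(n,j)$ denotes the coefficient of $x^j$ in $P_n(x)$. For $0\le k\le \lfloor (n+1)/2\rfloor$, $E(n,k,s)$ denotes the coefficient of $x^s$ in $(1-x)^{2k}(1+x)^{n-2k}$. -}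

module Defs where

open import Data.Nat using (ℕ; zero; suc; _+_; _*_; _∸_; _<ᵇ_; _≡ᵇ_; _/_)
open import Data.Bool using (Bool; true; false; if_then_else_)
open import Data.List using (List; []; _∷_; length; map; concatMap; filterᵇ; upTo; sum)
open import Data.Integer as ℤ using (ℤ; +_)

-- Permutations of {1,…,m}, as one-line words [π(1),…,π(m)].

insertions : ℕ → List ℕ → List (List ℕ)
insertions x []       = (x ∷ []) ∷ []
insertions x (y ∷ ys) = (x ∷ y ∷ ys) ∷ map (y ∷_) (insertions x ys)

perms : List ℕ → List (List ℕ)
perms []       = [] ∷ []
perms (x ∷ xs) = concatMap (insertions x) (perms xs)

oneTo : ℕ → List ℕ
oneTo m = map suc (upTo m)

Sym : ℕ → List (List ℕ)
Sym m = perms (oneTo m)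

-- Alternating descents.
-- Position i (1-based, 1 ≤ i ≤ m-1) is an alternating descent iff
--   i even and π(i) < π(i+1), or i odd and π(i) > π(i+1).

even? : ℕ → Bool
even? zero          = true
even? (suc zero)    = false
even? (suc (suc n)) = even? n

altDesAt : ℕ → ℕ → ℕ → ℕ
altDesAt i a b = if even? i then (if a <ᵇ b then 1 else 0)
                            else (if b <ᵇ a then 1 else 0)

-- altdes counted from position i onwards, on the word starting at π(i)
altdesFrom : ℕ → List ℕ → ℕ
altdesFrom i []           = 0
altdesFrom i (a ∷ [])     = 0
altdesFrom i (a ∷ b ∷ w)  = altDesAt i a b + altdesFrom (suc i) (b ∷ w)

altdes : List ℕ → ℕ
altdes π = altdesFrom 1 π

altEuler : ℕ → ℕ → ℕ
altEuler m k = length (filterᵇ (λ π → altdes π ≡ᵇ k) (Sym m))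

-- Polynomials with integer coefficients, as coefficient lists
-- (constant term first).

Poly : Set
Poly = List ℤ

addP : Poly → Poly → Poly
addP []       q        = q
addP (a ∷ p)  []       = a ∷ p
addP (a ∷ p)  (b ∷ q)  = (a ℤ.+ b) ∷ addP p q

scaleP : ℤ → Poly → Poly
scaleP c p = map (c ℤ.*_) p

mulP : Poly → Poly → Poly
mulP []      q = []
mulP (a ∷ p) q = addP (scaleP a q) (+ 0 ∷ mulP p q)

powP : Poly → ℕ → Poly
powP p zero    = + 1 ∷ []
powP p (suc n) = mulP p (powP p n)

coeff : Poly → ℕ → ℤ
coeff []      j       = + 0
coeff (a ∷ p) zero    = a
coeff (a ∷ p) (suc j) = coeff p j

derivFrom : ℕ → Poly → Poly
derivFrom i []      = []
derivFrom i (a ∷ p) = (+ i ℤ.* a) ∷ derivFrom (suc i) p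

deriv : Poly → Poly
deriv []      = []
deriv (a ∷ p) = derivFrom 1 p

onePlusX² : Poly
onePlusX² = + 1 ∷ + 0 ∷ + 1 ∷ []

P : ℕ → Poly
P zero    = + 0 ∷ + 1 ∷ []
P (suc n) = mulP onePlusX² (deriv (P n))

p : ℕ → ℕ → ℤ
p n j = coeff (P n) j

-- E(n,k,s) = coefficient of x^s in (1-x)^{2k} (1+x)^{n-2k}.
-- (For the single index k = (n+1)/2 with n odd, n-2k = -1 is replaced by the
--  truncated 0; that term is multiplied by n-2k+1 = 0 in the theorem.)

oneMinusX onePlusX : Poly
oneMinusX = + 1 ∷ ℤ.- (+ 1) ∷ []
onePlusX  = + 1 ∷ + 1 ∷ []

E : ℕ → ℕ → ℕ → ℤ
E n k s = coeff (mulP (powP oneMinusX (2 * k)) (powP onePlusX (n ∸ 2 * k))) s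

rhsTerm : ℕ → ℕ → ℕ → ℤ
rhsTerm n s k = (+ (suc n ∸ 2 * k)) ℤ.* (p n (suc n ∸ 2 * k) ℤ.* E n k s)

sumℤ : List ℤ → ℤ
sumℤ []       = + 0
sumℤ (x ∷ xs) = x ℤ.+ sumℤ xs

rhsSum : ℕ → ℕ → ℤ
rhsSum n s = sumℤ (map (rhsTerm n s) (upTo (suc ((suc n) / 2))))

module Submission where

-- Both sides of the identity, read as sequences in s, obey one recurrence
--   F_{n+1}(s) = (s+1) (F_n(s+1) + F_n(s-1)) + (n+2-s) (F_n(s) + F_n(s-2))          (T n)
-- and agree at n = 0; hence they agree for all n and s.
--
-- Coefficients: with B_{a,b} the coefficient sequence of (1-x)^a (1+x)^b, the operator is
-- T n f = 2(1+x) f + n (1+x²) f + (1+x²)(1-x) f', which gives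
--   T_{a+b} B_{a,b} = (b+2) B_{a,b+1} + b B_{a+2,b-1}.
-- The weights q(n,k) = (n+1-2k) p(n,n+1-2k) satisfy q(n+1,k+1) = (n-2k)(q(n,k+1) + q(n,k)),
-- by P_{n+1} = (1+x²) P_n'.  Together: R_{n+1} = T_n R_n for R_n = Σ_k q(n,k) B_{2k,n-2k}.
--
-- Counting: 2 A(m+1,k) = (k+1)(A(m,k+1) + A(m,k-1)) + (m+1-k)(A(m,k) + A(m,k-2)).  Count
-- A(m+1,k) once directly and once through complements, write each π ∈ 𝔖_{m+1} as 1
-- inserted at position j into a (suitably twisted) w ∈ 𝔖_m, and compute the alternating
-- descents of the result from those of w.  Then 2^n A(n+1,·) satisfies the recurrence.

module Coefficients where

  open import Defs
  open import Data.Nat as N using (ℕ; zero; suc; _≤_; _<_; s≤s; _≤?_; _/_)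
  import Data.Nat.Properties as NP
  open import Data.Nat.DivMod using (m≡m%n+[m/n]*n; m%n<n; m/n≤m)
  open import Data.Integer using (ℤ; +_; _+_; _*_; _-_; -_)
  import Data.Integer.Properties as ZP
  open import Algebra.Properties.CommutativeSemigroup ZP.+-commutativeSemigroup using () renaming (interchange to +-interchange)
  open import Data.Integer.Tactic.RingSolver using (solve-∀)
  open import Data.List using ([]; _∷_; map; applyUpTo)
  open import Relation.Binary.PropositionalEquality
  open import Relation.Nullary using (yes; no)
  open ≡-Reasoning

  -- A polynomial is handled through its coefficient sequence s ↦ coeff p s.

  Seq : Set
  Seq = ℕ → ℤ

  -- Coefficients of x · f.
  shift : Seq → Seq
  shift f zero    = + 0
  shift f (suc s) = f s

  shift-cong : ∀ {f g} → f ≗ g → shift f ≗ shift g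
  shift-cong e zero    = refl
  shift-cong e (suc s) = e s

  coeff-addP : ∀ p q s → coeff (addP p q) s ≡ coeff p s + coeff q s
  coeff-addP []      q       s       = sym (ZP.+-identityˡ _)
  coeff-addP (a ∷ p) []      s       = sym (ZP.+-identityʳ _)
  coeff-addP (a ∷ p) (b ∷ q) zero    = refl
  coeff-addP (a ∷ p) (b ∷ q) (suc s) = coeff-addP p q s

  coeff-scaleP : ∀ c p s → coeff (scaleP c p) s ≡ c * coeff p s
  coeff-scaleP c []      s       = sym (ZP.*-zeroʳ c)
  coeff-scaleP c (a ∷ p) zero    = refl
  coeff-scaleP c (a ∷ p) (suc s) = coeff-scaleP c p s

  coeff-mulP-cons : ∀ a p q s → coeff (mulP (a ∷ p) q) s ≡ a * coeff q s + shift (coeff (mulP p q)) s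
  coeff-mulP-cons a p q zero = trans (coeff-addP (scaleP a q) (+ 0 ∷ mulP p q) zero)
                                     (cong (_+ + 0) (coeff-scaleP a q zero))
  coeff-mulP-cons a p q (suc s) = trans (coeff-addP (scaleP a q) (+ 0 ∷ mulP p q) (suc s))
                                        (cong (_+ coeff (mulP p q) s) (coeff-scaleP a q (suc s)))

  shift-zero : ∀ s → shift (λ _ → + 0) s ≡ + 0
  shift-zero zero    = refl
  shift-zero (suc s) = refl

  coeff-one-mul : ∀ q s → coeff (mulP (+ 1 ∷ []) q) s ≡ coeff q s
  coeff-one-mul q s = begin
    coeff (mulP (+ 1 ∷ []) q) s            ≡⟨ coeff-mulP-cons (+ 1) [] q s ⟩
    + 1 * coeff q s + shift (λ _ → + 0) s  ≡⟨ cong₂ _+_ (ZP.*-identityˡ (coeff q s)) (shift-zero s) ⟩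
    coeff q s + + 0                        ≡⟨ ZP.+-identityʳ (coeff q s) ⟩
    coeff q s                              ∎

  coeff-mul-one : ∀ p → coeff (mulP p (+ 1 ∷ [])) ≗ coeff p
  coeff-mul-one []      s       = refl
  coeff-mul-one (a ∷ p) zero    = trans (coeff-mulP-cons a p (+ 1 ∷ []) zero)
    (trans (ZP.+-identityʳ (a * + 1)) (ZP.*-identityʳ a))
  coeff-mul-one (a ∷ p) (suc s) = trans (coeff-mulP-cons a p (+ 1 ∷ []) (suc s))
    (trans (cong (_+ coeff (mulP p (+ 1 ∷ [])) s) (ZP.*-zeroʳ a))
    (trans (ZP.+-identityˡ _) (coeff-mul-one p s)))

  coeff-linear-mul : ∀ c₀ c₁ q s →
    coeff (mulP (c₀ ∷ c₁ ∷ []) q) s ≡ c₀ * coeff q s + c₁ * shift (coeff q) s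
  coeff-linear-mul c₀ c₁ q zero = begin
    coeff (mulP (c₀ ∷ c₁ ∷ []) q) zero  ≡⟨ coeff-mulP-cons c₀ (c₁ ∷ []) q zero ⟩
    c₀ * coeff q zero + + 0             ≡⟨ cong (λ z → c₀ * coeff q zero + z) (sym (ZP.*-zeroʳ c₁)) ⟩
    c₀ * coeff q zero + c₁ * + 0        ∎
  coeff-linear-mul c₀ c₁ q (suc s) = begin
    coeff (mulP (c₀ ∷ c₁ ∷ []) q) (suc s)
      ≡⟨ coeff-mulP-cons c₀ (c₁ ∷ []) q (suc s) ⟩
    c₀ * coeff q (suc s) + coeff (mulP (c₁ ∷ []) q) s
      ≡⟨ cong (λ z → c₀ * coeff q (suc s) + z) (coeff-mulP-cons c₁ [] q s) ⟩
    c₀ * coeff q (suc s) + (c₁ * coeff q s + shift (λ _ → + 0) s)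
      ≡⟨ cong (λ z → c₀ * coeff q (suc s) + (c₁ * coeff q s + z)) (shift-zero s) ⟩
    c₀ * coeff q (suc s) + (c₁ * coeff q s + + 0)
      ≡⟨ cong (λ z → c₀ * coeff q (suc s) + z) (ZP.+-identityʳ (c₁ * coeff q s)) ⟩
    c₀ * coeff q (suc s) + c₁ * coeff q s ∎

  -- … and inside a product p · ((c₀ + c₁ x) q), as needed to peel one factor
  -- off  powP onePlusX (suc b)  in  (1-x)^a (1+x)^(b+1).
  coeff-mul-linear-mul : ∀ c₀ c₁ p q s → coeff (mulP p (mulP (c₀ ∷ c₁ ∷ []) q)) s
    ≡ c₀ * coeff (mulP p q) s + c₁ * shift (coeff (mulP p q)) s
  coeff-mul-linear-mul c₀ c₁ [] q zero    = sym (cong₂ _+_ (ZP.*-zeroʳ c₀) (ZP.*-zeroʳ c₁))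
  coeff-mul-linear-mul c₀ c₁ [] q (suc s) = sym (cong₂ _+_ (ZP.*-zeroʳ c₀) (ZP.*-zeroʳ c₁))
  coeff-mul-linear-mul c₀ c₁ (a ∷ p) q zero = begin
    coeff (mulP (a ∷ p) r) zero                  ≡⟨ coeff-mulP-cons a p r zero ⟩
    a * coeff r zero + + 0                       ≡⟨ cong (λ z → a * z + + 0) (coeff-linear-mul c₀ c₁ q zero) ⟩
    a * (c₀ * coeff q zero + c₁ * + 0) + + 0     ≡⟨ regroup a c₀ c₁ (coeff q zero) ⟩
    c₀ * (a * coeff q zero + + 0) + c₁ * + 0     ≡⟨ cong (λ z → c₀ * z + c₁ * + 0) (sym (coeff-mulP-cons a p q zero)) ⟩
    c₀ * coeff (mulP (a ∷ p) q) zero + c₁ * + 0  ∎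
    where
    r = mulP (c₀ ∷ c₁ ∷ []) q
    regroup : ∀ a c₀ c₁ y → a * (c₀ * y + c₁ * + 0) + + 0 ≡ c₀ * (a * y + + 0) + c₁ * + 0
    regroup = solve-∀
  coeff-mul-linear-mul c₀ c₁ (a ∷ p) q (suc s) = begin
    coeff (mulP (a ∷ p) r) (suc s)
      ≡⟨ coeff-mulP-cons a p r (suc s) ⟩
    a * coeff r (suc s) + coeff (mulP p r) s
      ≡⟨ cong₂ (λ z w → a * z + w) (coeff-linear-mul c₀ c₁ q (suc s)) (coeff-mul-linear-mul c₀ c₁ p q s) ⟩
    a * (c₀ * coeff q (suc s) + c₁ * coeff q s) + (c₀ * coeff pq s + c₁ * shift (coeff pq) s)
      ≡⟨ regroup a c₀ c₁ (coeff q (suc s)) (coeff q s) (coeff pq s) (shift (coeff pq) s) ⟩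
    c₀ * (a * coeff q (suc s) + coeff pq s) + c₁ * (a * coeff q s + shift (coeff pq) s)
      ≡⟨ cong₂ (λ z w → c₀ * z + c₁ * w) (sym (coeff-mulP-cons a p q (suc s))) (sym (coeff-mulP-cons a p q s)) ⟩
    c₀ * coeff (mulP (a ∷ p) q) (suc s) + c₁ * coeff (mulP (a ∷ p) q) s ∎
    where
    r  = mulP (c₀ ∷ c₁ ∷ []) q
    pq = mulP p q
    regroup : ∀ a c₀ c₁ y y' m m' →
      a * (c₀ * y + c₁ * y') + (c₀ * m + c₁ * m') ≡ c₀ * (a * y + m) + c₁ * (a * y' + m')
    regroup = solve-∀

  -- Coefficients of the derivative: (∂ f)(s) = (s+1) f(s+1).
  ∂ : Seq → Seq
  ∂ f s = + suc s * f (suc s)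

  ∂-cong : ∀ {f g} → f ≗ g → ∂ f ≗ ∂ g
  ∂-cong e s = cong (+ suc s *_) (e (suc s))

  coeff-derivFrom : ∀ i p s → coeff (derivFrom i p) s ≡ + (i N.+ s) * coeff p s
  coeff-derivFrom i []      s       = sym (ZP.*-zeroʳ (+ (i N.+ s)))
  coeff-derivFrom i (a ∷ p) zero    = cong (λ z → + z * a) (sym (NP.+-identityʳ i))
  coeff-derivFrom i (a ∷ p) (suc s) = trans (coeff-derivFrom (suc i) p s)
    (cong (λ z → + z * coeff p s) (sym (NP.+-suc i s)))

  coeff-deriv : ∀ p → coeff (deriv p) ≗ ∂ (coeff p)
  coeff-deriv []      s = sym (ZP.*-zeroʳ (+ suc s))
  coeff-deriv (a ∷ p) s = coeff-derivFrom 1 p s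

  by1+x by1-x by1+x² : Seq → Seq
  by1+x  f s = f s + shift f s
  by1-x  f s = f s - shift f s
  by1+x² f s = f s + shift (shift f) s

  by1+x-cong : ∀ {f g} → f ≗ g → by1+x f ≗ by1+x g
  by1+x-cong e s = cong₂ _+_ (e s) (shift-cong e s)

  by1-x-cong : ∀ {f g} → f ≗ g → by1-x f ≗ by1-x g
  by1-x-cong e s = cong₂ _-_ (e s) (shift-cong e s)

  by1+x²-cong : ∀ {f g} → f ≗ g → by1+x² f ≗ by1+x² g
  by1+x²-cong e s = cong₂ _+_ (e s) (shift-cong (shift-cong e) s)

  coeff-by1+x² : ∀ q → coeff (mulP onePlusX² q) ≗ by1+x² (coeff q)
  coeff-by1+x² q s = begin
    coeff (mulP onePlusX² q) s                             ≡⟨ coeff-mulP-cons (+ 1) (+ 0 ∷ + 1 ∷ []) q s ⟩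
    + 1 * coeff q s + shift (coeff (mulP x·1 q)) s         ≡⟨ cong₂ _+_ (ZP.*-identityˡ (coeff q s)) (shift-cong by-x s) ⟩
    coeff q s + shift (shift (coeff q)) s                  ∎
    where
    x·1 = + 0 ∷ + 1 ∷ []
    by-x : coeff (mulP x·1 q) ≗ shift (coeff q)
    by-x t = begin
      coeff (mulP x·1 q) t                                   ≡⟨ coeff-mulP-cons (+ 0) (+ 1 ∷ []) q t ⟩
      + 0 * coeff q t + shift (coeff (mulP (+ 1 ∷ []) q)) t  ≡⟨ ZP.+-identityˡ _ ⟩
      shift (coeff (mulP (+ 1 ∷ []) q)) t                    ≡⟨ shift-cong (coeff-one-mul q) t ⟩
      shift (coeff q) t                                      ∎

  pcoef : ℕ → Seq
  pcoef zero zero                = + 0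
  pcoef zero (suc zero)          = + 1
  pcoef zero (suc (suc _))       = + 0
  pcoef (suc n) s                = by1+x² (∂ (pcoef n)) s

  coeff-P : ∀ n → coeff (P n) ≗ pcoef n
  coeff-P zero zero                = refl
  coeff-P zero (suc zero)          = refl
  coeff-P zero (suc (suc s))       = refl
  coeff-P (suc n) s = trans (coeff-by1+x² (deriv (P n)) s)
    (by1+x²-cong (λ t → trans (coeff-deriv (P n) t) (∂-cong (coeff-P n) t)) s)

  one : Seq
  one zero    = + 1
  one (suc _) = + 0

  minusPow : ℕ → Seq
  minusPow zero    = one
  minusPow (suc a) = by1-x (minusPow a)

  mixedPow : ℕ → ℕ → Seq
  mixedPow a zero    = minusPow a
  mixedPow a (suc b) = by1+x (mixedPow a b)

  coeff-minusPow : ∀ a → coeff (powP oneMinusX a) ≗ minusPow a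
  coeff-minusPow zero zero          = refl
  coeff-minusPow zero (suc zero)    = refl
  coeff-minusPow zero (suc (suc s)) = refl
  coeff-minusPow (suc a) s = begin
    coeff (mulP oneMinusX q) s                       ≡⟨ coeff-linear-mul (+ 1) (- (+ 1)) q s ⟩
    + 1 * coeff q s + - (+ 1) * shift (coeff q) s   ≡⟨ by1-x-as-linear (coeff q s) (shift (coeff q) s) ⟩
    by1-x (coeff q) s                                ≡⟨ by1-x-cong (coeff-minusPow a) s ⟩
    minusPow (suc a) s                               ∎
    where
    q = powP oneMinusX a
    by1-x-as-linear : ∀ y z → + 1 * y + - (+ 1) * z ≡ y - z
    by1-x-as-linear = solve-∀

  coeff-mixedPow : ∀ a b → coeff (mulP (powP oneMinusX a) (powP onePlusX b)) ≗ mixedPow a b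
  coeff-mixedPow a zero s = trans (coeff-mul-one (powP oneMinusX a) s) (coeff-minusPow a s)
  coeff-mixedPow a (suc b) s = begin
    coeff (mulP (powP oneMinusX a) (mulP onePlusX (powP onePlusX b))) s
      ≡⟨ coeff-mul-linear-mul (+ 1) (+ 1) (powP oneMinusX a) (powP onePlusX b) s ⟩
    + 1 * coeff m s + + 1 * shift (coeff m) s  ≡⟨ by1+x-as-linear (coeff m s) (shift (coeff m) s) ⟩
    by1+x (coeff m) s                          ≡⟨ by1+x-cong (coeff-mixedPow a b) s ⟩
    mixedPow a (suc b) s                       ∎
    where
    m = mulP (powP oneMinusX a) (powP onePlusX b)
    by1+x-as-linear : ∀ y z → + 1 * y + + 1 * z ≡ y + z
    by1+x-as-linear = solve-∀

  E≡mixedPow : ∀ n k s → E n k s ≡ mixedPow (2 N.* k) (n N.∸ 2 N.* k) s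
  E≡mixedPow n k s = coeff-mixedPow (2 N.* k) (n N.∸ 2 N.* k) s

  T : ℕ → Seq → Seq
  T n f s = + suc s * (f (suc s) + shift f s) + (+ (2 N.+ n) - + s) * (f s + shift (shift f) s)

  T-cong : ∀ n {f g} → f ≗ g → T n f ≗ T n g
  T-cong n e s = cong₂ (λ x y → + suc s * x + (+ (2 N.+ n) - + s) * y)
    (cong₂ _+_ (e (suc s)) (shift-cong e s)) (cong₂ _+_ (e s) (shift-cong (shift-cong e) s))

  T-decomposition : ∀ n f s →
    T n f s ≡ + 2 * by1+x f s + + n * by1+x² f s + by1+x² (by1-x (∂ f)) s
  T-decomposition n f zero                = at₀ (+ n) (f 0) (f 1)
    where
    at₀ : ∀ n f₀ f₁ → + 1 * (f₁ + + 0) + (+ 2 + n - + 0) * (f₀ + + 0)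
      ≡ + 2 * (f₀ + + 0) + n * (f₀ + + 0) + ((+ 1 * f₁ - + 0) + + 0)
    at₀ = solve-∀
  T-decomposition n f (suc zero)          = at₁ (+ n) (f 0) (f 1) (f 2)
    where
    at₁ : ∀ n f₀ f₁ f₂ → + 2 * (f₂ + f₀) + (+ 2 + n - + 1) * (f₁ + + 0)
      ≡ + 2 * (f₁ + f₀) + n * (f₁ + + 0) + ((+ 2 * f₂ - + 1 * f₁) + + 0)
    at₁ = solve-∀
  T-decomposition n f (suc (suc zero))    = at₂ (+ n) (f 0) (f 1) (f 2) (f 3)
    where
    at₂ : ∀ n f₀ f₁ f₂ f₃ → + 3 * (f₃ + f₁) + (+ 2 + n - + 2) * (f₂ + f₀)
      ≡ + 2 * (f₂ + f₁) + n * (f₂ + f₀) + ((+ 3 * f₃ - + 2 * f₂) + (+ 1 * f₁ - + 0))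
    at₂ = solve-∀
  T-decomposition n f (suc (suc (suc t))) =
    at₃₊ (+ n) (+ t) (f (1 N.+ t)) (f (2 N.+ t)) (f (3 N.+ t)) (f (4 N.+ t))
    where
    at₃₊ : ∀ n t f₁ f₂ f₃ f₄ → (+ 4 + t) * (f₄ + f₂) + (+ 2 + n - (+ 3 + t)) * (f₃ + f₁)
      ≡ + 2 * (f₃ + f₂) + n * (f₃ + f₁)
        + (((+ 4 + t) * f₄ - (+ 3 + t) * f₃) + ((+ 2 + t) * f₂ - (+ 1 + t) * f₁))
    at₃₊ = solve-∀

  ∂-by1+x : ∀ f s → ∂ (by1+x f) s ≡ by1+x (∂ f) s + f s
  ∂-by1+x f zero    = at₀ (f 0) (f 1)
    where
    at₀ : ∀ f₀ f₁ → + 1 * (f₁ + f₀) ≡ (+ 1 * f₁ + + 0) + f₀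
    at₀ = solve-∀
  ∂-by1+x f (suc t) = at₊ (+ t) (f (suc t)) (f (suc (suc t)))
    where
    at₊ : ∀ t f₁ f₂ → (+ 2 + t) * (f₂ + f₁) ≡ ((+ 2 + t) * f₂ + (+ 1 + t) * f₁) + f₁
    at₊ = solve-∀

  ∂-by1-x : ∀ f s → ∂ (by1-x f) s ≡ by1-x (∂ f) s - f s
  ∂-by1-x f zero    = at₀ (f 0) (f 1)
    where
    at₀ : ∀ f₀ f₁ → + 1 * (f₁ - f₀) ≡ (+ 1 * f₁ - + 0) - f₀
    at₀ = solve-∀
  ∂-by1-x f (suc t) = at₊ (+ t) (f (suc t)) (f (suc (suc t)))
    where
    at₊ : ∀ t f₁ f₂ → (+ 2 + t) * (f₂ - f₁) ≡ ((+ 2 + t) * f₂ - (+ 1 + t) * f₁) - f₁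
    at₊ = solve-∀

  -- The multiplication operators are linear; the combination c f - d g is the shape
  -- in which the derivative of (1-x)^a (1+x)^b appears.  (At the left boundary the
  -- shifted terms are the literal + 0, whence the separate identities.)
  private
    lin-+ : ∀ c d x x' y y' → (c * x - d * y) + (c * x' - d * y') ≡ c * (x + x') - d * (y + y')
    lin-+ = solve-∀
    lin-- : ∀ c d x x' y y' → (c * x - d * y) - (c * x' - d * y') ≡ c * (x - x') - d * (y - y')
    lin-- = solve-∀
    lin-+0 : ∀ c d x y → (c * x - d * y) + + 0 ≡ c * (x + + 0) - d * (y + + 0)
    lin-+0 = solve-∀
    lin--0 : ∀ c d x y → (c * x - d * y) - + 0 ≡ c * (x - + 0) - d * (y - + 0)
    lin--0 = solve-∀

  by1+x-lin : ∀ c d f g s → by1+x (λ t → c * f t - d * g t) s ≡ c * by1+x f s - d * by1+x g s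
  by1+x-lin c d f g zero    = lin-+0 c d (f 0) (g 0)
  by1+x-lin c d f g (suc s) = lin-+ c d (f (suc s)) (f s) (g (suc s)) (g s)

  by1-x-lin : ∀ c d f g s → by1-x (λ t → c * f t - d * g t) s ≡ c * by1-x f s - d * by1-x g s
  by1-x-lin c d f g zero    = lin--0 c d (f 0) (g 0)
  by1-x-lin c d f g (suc s) = lin-- c d (f (suc s)) (f s) (g (suc s)) (g s)

  by1+x²-lin : ∀ c d f g s → by1+x² (λ t → c * f t - d * g t) s ≡ c * by1+x² f s - d * by1+x² g s
  by1+x²-lin c d f g zero          = lin-+0 c d (f 0) (g 0)
  by1+x²-lin c d f g (suc zero)    = lin-+0 c d (f 1) (g 1)
  by1+x²-lin c d f g (suc (suc s)) = lin-+ c d (f (suc (suc s))) (f s) (g (suc (suc s))) (g s)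

  -- (1-x) and (1+x) commute, so (1-x) · mixedPow a b = mixedPow (a+1) b.
  by1-x-by1+x : ∀ f → by1-x (by1+x f) ≗ by1+x (by1-x f)
  by1-x-by1+x f zero    = at₀ (f 0)
    where
    at₀ : ∀ x → (x + + 0) - + 0 ≡ (x - + 0) + + 0
    at₀ = solve-∀
  by1-x-by1+x f (suc s) = at₊ (f (suc s)) (f s) (shift f s)
    where
    at₊ : ∀ x y z → (x + y) - (y + z) ≡ (x - y) + (y - z)
    at₊ = solve-∀

  by1-x-mixedPow : ∀ a b → by1-x (mixedPow a b) ≗ mixedPow (suc a) b
  by1-x-mixedPow a zero    s = refl
  by1-x-mixedPow a (suc b) s = trans (by1-x-by1+x (mixedPow a b) s) (by1+x-cong (by1-x-mixedPow a b) s)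

  by1+x²-by1±x : ∀ f s → by1+x² (by1+x f) s + by1+x² (by1-x f) s ≡ by1+x (by1+x f) s + by1-x (by1-x f) s
  by1+x²-by1±x f zero          = at₀ (f 0)
    where
    at₀ : ∀ y₀ → (y₀ + + 0 + + 0) + ((y₀ - + 0) + + 0) ≡ ((y₀ + + 0) + + 0) + ((y₀ - + 0) - + 0)
    at₀ = solve-∀
  by1+x²-by1±x f (suc zero)    = at₁ (f 0) (f 1)
    where
    at₁ : ∀ y₀ y₁ → (y₁ + y₀ + + 0) + ((y₁ - y₀) + + 0) ≡ ((y₁ + y₀) + (y₀ + + 0)) + ((y₁ - y₀) - (y₀ - + 0))
    at₁ = solve-∀
  by1+x²-by1±x f (suc (suc s)) = at₂₊ (f s) (f (suc s)) (f (suc (suc s))) (shift f s)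
    where
    at₂₊ : ∀ y₀ y₁ y₂ z → ((y₂ + y₁) + (y₀ + z)) + ((y₂ - y₁) + (y₀ - z))
                        ≡ ((y₂ + y₁) + (y₁ + y₀)) + ((y₂ - y₁) - (y₁ - y₀))
    at₂₊ = solve-∀

  -- ((1-x)^a)' = -a (1-x)^(a-1), in the shape 0 · (1-x)^a - a (1-x)^(a-1) of ∂-mixedPow.
  ∂-minusPow : ∀ a s → ∂ (minusPow a) s ≡ + 0 * minusPow a s - + a * minusPow (a N.∸ 1) s
  ∂-minusPow zero s = vanish (+ suc s) (one s) (one s)
    where
    vanish : ∀ c x y → c * + 0 ≡ + 0 * x - + 0 * y
    vanish = solve-∀
  ∂-minusPow (suc zero) s = begin
    ∂ (by1-x one) s                                  ≡⟨ ∂-by1-x one s ⟩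
    by1-x (∂ one) s - one s                          ≡⟨ cong (_- one s) (trans (by1-x-cong (∂-minusPow zero) s)
                                                              (by1-x-lin (+ 0) (+ 0) one one s)) ⟩
    (+ 0 * by1-x one s - + 0 * by1-x one s) - one s  ≡⟨ collect (by1-x one s) (by1-x one s) (one s) ⟩
    + 0 * by1-x one s - + 1 * one s                  ∎
    where
    collect : ∀ v z x → (+ 0 * v - + 0 * z) - x ≡ + 0 * v - + 1 * x
    collect = solve-∀
  ∂-minusPow (suc (suc a)) s = begin
    ∂ (by1-x f) s                                               ≡⟨ ∂-by1-x f s ⟩
    by1-x (∂ f) s - f s                                         ≡⟨ cong (_- f s) (trans (by1-x-cong (∂-minusPow (suc a)) s)
                                                                          (by1-x-lin (+ 0) (+ suc a) f (minusPow a) s)) ⟩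
    (+ 0 * by1-x f s - + suc a * by1-x (minusPow a) s) - f s    ≡⟨ collect (+ suc a) (by1-x f s) (f s) ⟩
    + 0 * by1-x f s - + suc (suc a) * f s                       ∎
    where
    f = minusPow (suc a)
    collect : ∀ A v x → (+ 0 * v - A * x) - x ≡ + 0 * v - (+ 1 + A) * x
    collect = solve-∀

  ∂-mixedPow : ∀ a b s → ∂ (mixedPow a b) s ≡ + b * mixedPow a (b N.∸ 1) s - + a * mixedPow (a N.∸ 1) b s
  ∂-mixedPow a zero s = ∂-minusPow a s
  ∂-mixedPow a (suc zero) s = begin
    ∂ (by1+x f) s                                          ≡⟨ ∂-by1+x f s ⟩
    by1+x (∂ f) s + f s                                    ≡⟨ cong (_+ f s) (trans (by1+x-cong (∂-mixedPow a zero) s)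
                                                                     (by1+x-lin (+ 0) (+ a) f (mixedPow (a N.∸ 1) zero) s)) ⟩
    (+ 0 * by1+x f s - + a * mixedPow (a N.∸ 1) 1 s) + f s ≡⟨ collect (+ a) (by1+x f s) (f s) (mixedPow (a N.∸ 1) 1 s) ⟩
    + 1 * f s - + a * mixedPow (a N.∸ 1) 1 s               ∎
    where
    f = mixedPow a zero
    collect : ∀ A u x y → (+ 0 * u - A * y) + x ≡ + 1 * x - A * y
    collect = solve-∀
  ∂-mixedPow a (suc (suc b)) s = begin
    ∂ (by1+x f) s
      ≡⟨ ∂-by1+x f s ⟩
    by1+x (∂ f) s + f s
      ≡⟨ cong (_+ f s) (trans (by1+x-cong (∂-mixedPow a (suc b)) s)
                              (by1+x-lin (+ suc b) (+ a) (mixedPow a b) (mixedPow (a N.∸ 1) (suc b)) s)) ⟩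
    (+ suc b * f s - + a * mixedPow (a N.∸ 1) (suc (suc b)) s) + f s
      ≡⟨ collect (+ suc b) (+ a) (f s) (mixedPow (a N.∸ 1) (suc (suc b)) s) ⟩
    + suc (suc b) * f s - + a * mixedPow (a N.∸ 1) (suc (suc b)) s ∎
    where
    f = mixedPow a (suc b)
    collect : ∀ B A x y → (B * x - A * y) + x ≡ (+ 1 + B) * x - A * y
    collect = solve-∀

  by1-x-∂-mixedPow : ∀ a b s →
    by1-x (∂ (mixedPow a b)) s ≡ + b * mixedPow (suc a) (b N.∸ 1) s - + a * mixedPow a b s
  by1-x-∂-mixedPow zero b s = begin
    by1-x (∂ (mixedPow 0 b)) s
      ≡⟨ trans (by1-x-cong (∂-mixedPow 0 b) s) (by1-x-lin (+ b) (+ 0) (mixedPow 0 (b N.∸ 1)) (mixedPow 0 b) s) ⟩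
    + b * by1-x (mixedPow 0 (b N.∸ 1)) s - + 0 * by1-x (mixedPow 0 b) s
      ≡⟨ cong (λ z → + b * z - + 0 * by1-x (mixedPow 0 b) s) (by1-x-mixedPow 0 (b N.∸ 1) s) ⟩
    + b * mixedPow 1 (b N.∸ 1) s - + 0 * by1-x (mixedPow 0 b) s
      ≡⟨ cong (λ z → + b * mixedPow 1 (b N.∸ 1) s - z)
              (trans (ZP.*-zeroˡ (by1-x (mixedPow 0 b) s)) (sym (ZP.*-zeroˡ (mixedPow 0 b s)))) ⟩
    + b * mixedPow 1 (b N.∸ 1) s - + 0 * mixedPow 0 b s ∎
  by1-x-∂-mixedPow (suc a) b s = begin
    by1-x (∂ (mixedPow (suc a) b)) s
      ≡⟨ trans (by1-x-cong (∂-mixedPow (suc a) b) s)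
               (by1-x-lin (+ b) (+ suc a) (mixedPow (suc a) (b N.∸ 1)) (mixedPow a b) s) ⟩
    + b * by1-x (mixedPow (suc a) (b N.∸ 1)) s - + suc a * by1-x (mixedPow a b) s
      ≡⟨ cong₂ (λ z w → + b * z - + suc a * w) (by1-x-mixedPow (suc a) (b N.∸ 1) s) (by1-x-mixedPow a b s) ⟩
    + b * mixedPow (suc (suc a)) (b N.∸ 1) s - + suc a * mixedPow (suc a) b s ∎

  -- (1+x²) B_{a,b+1} + (1+x²) B_{a+1,b} = B_{a,b+2} + B_{a+2,b}, since 2 (1+x²) = (1+x)² + (1-x)².
  square-trade : ∀ a b s → by1+x² (mixedPow a (suc b)) s + by1+x² (mixedPow (suc a) b) s
                         ≡ mixedPow a (suc (suc b)) s + mixedPow (2 N.+ a) b s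
  square-trade a b s = begin
    by1+x² (by1+x y) s + by1+x² (mixedPow (suc a) b) s
      ≡⟨ cong (λ z → by1+x² (by1+x y) s + z) (by1+x²-cong (λ t → sym (by1-x-mixedPow a b t)) s) ⟩
    by1+x² (by1+x y) s + by1+x² (by1-x y) s
      ≡⟨ by1+x²-by1±x y s ⟩
    by1+x (by1+x y) s + by1-x (by1-x y) s
      ≡⟨ cong (λ z → by1+x (by1+x y) s + z) (trans (by1-x-cong (by1-x-mixedPow a b) s) (by1-x-mixedPow (suc a) b s)) ⟩
    mixedPow a (suc (suc b)) s + mixedPow (2 N.+ a) b s ∎
    where y = mixedPow a b

  T-mixedPow : ∀ a b s → T (a N.+ b) (mixedPow a b) s
    ≡ + (2 N.+ b) * mixedPow a (suc b) s + + b * mixedPow (2 N.+ a) (b N.∸ 1) s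
  T-mixedPow a b s = begin
    T (a N.+ b) f s
      ≡⟨ T-decomposition (a N.+ b) f s ⟩
    + 2 * by1+x f s + + (a N.+ b) * by1+x² f s + by1+x² (by1-x (∂ f)) s
      ≡⟨ cong (λ z → + 2 * by1+x f s + + (a N.+ b) * by1+x² f s + z)
              (trans (by1+x²-cong (by1-x-∂-mixedPow a b) s) (by1+x²-lin (+ b) (+ a) f' f s)) ⟩
    + 2 * by1+x f s + + (a N.+ b) * by1+x² f s + (+ b * by1+x² f' s - + a * by1+x² f s)
      ≡⟨ combine b ⟩
    + (2 N.+ b) * mixedPow a (suc b) s + + b * mixedPow (2 N.+ a) (b N.∸ 1) s ∎
    where
    f  = mixedPow a b
    f' = mixedPow (suc a) (b N.∸ 1)
    cancel : ∀ A B P Q X → + 2 * X + (A + B) * P + (B * Q - A * P) ≡ + 2 * X + B * (P + Q)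
    cancel = solve-∀
    combine : ∀ b → + 2 * by1+x (mixedPow a b) s + + (a N.+ b) * by1+x² (mixedPow a b) s
                    + (+ b * by1+x² (mixedPow (suc a) (b N.∸ 1)) s - + a * by1+x² (mixedPow a b) s)
                  ≡ + (2 N.+ b) * mixedPow a (suc b) s + + b * mixedPow (2 N.+ a) (b N.∸ 1) s
    combine zero = begin
      + 2 * g + + (a N.+ 0) * h + (+ 0 * h' - + a * h)  ≡⟨ cancel (+ a) (+ 0) h h' g ⟩
      + 2 * g + + 0 * (h + h')                          ≡⟨ cong (λ z → + 2 * g + z) (trans (ZP.*-zeroˡ (h + h')) (sym (ZP.*-zeroˡ (mixedPow (2 N.+ a) 0 s)))) ⟩
      + 2 * g + + 0 * mixedPow (2 N.+ a) 0 s            ∎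
      where
      g  = by1+x (mixedPow a 0) s
      h  = by1+x² (mixedPow a 0) s
      h' = by1+x² (mixedPow (suc a) 0) s
    combine (suc b) = begin
      + 2 * g + + (a N.+ suc b) * u + (+ suc b * v - + a * u)   ≡⟨ cancel (+ a) (+ suc b) u v g ⟩
      + 2 * g + + suc b * (u + v)                               ≡⟨ cong (λ z → + 2 * g + + suc b * z) (square-trade a b s) ⟩
      + 2 * g + + suc b * (g + mixedPow (2 N.+ a) b s)          ≡⟨ regroup (+ suc b) g (mixedPow (2 N.+ a) b s) ⟩
      (+ 2 + + suc b) * g + + suc b * mixedPow (2 N.+ a) b s    ∎
      where
      g = mixedPow a (suc (suc b)) s
      u = by1+x² (mixedPow a (suc b)) s
      v = by1+x² (mixedPow (suc a) b) s
      regroup : ∀ B X Z → + 2 * X + B * (X + Z) ≡ (+ 2 + B) * X + B * Z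
      regroup = solve-∀

  Σℤ< : ℕ → (ℕ → ℤ) → ℤ
  Σℤ< zero    f = + 0
  Σℤ< (suc N) f = f 0 + Σℤ< N (λ k → f (suc k))

  sumℤ-applyUpTo : ∀ (h : ℕ → ℤ) (g : ℕ → ℕ) N → sumℤ (map h (applyUpTo g N)) ≡ Σℤ< N (λ k → h (g k))
  sumℤ-applyUpTo h g zero    = refl
  sumℤ-applyUpTo h g (suc N) = cong (λ z → h (g 0) + z) (sumℤ-applyUpTo h (λ k → g (suc k)) N)

  Σℤ<-cong : ∀ N {f g} → (∀ k → f k ≡ g k) → Σℤ< N f ≡ Σℤ< N g
  Σℤ<-cong zero    e = refl
  Σℤ<-cong (suc N) e = cong₂ _+_ (e 0) (Σℤ<-cong N (λ k → e (suc k)))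

  Σℤ<-add : ∀ N f g → Σℤ< N (λ k → f k + g k) ≡ Σℤ< N f + Σℤ< N g
  Σℤ<-add zero    f g = refl
  Σℤ<-add (suc N) f g = trans (cong (λ z → f 0 + g 0 + z) (Σℤ<-add N (λ k → f (suc k)) (λ k → g (suc k))))
    (+-interchange (f 0) (g 0) (Σℤ< N (λ k → f (suc k))) (Σℤ< N (λ k → g (suc k))))

  Σℤ<-zero : ∀ N → Σℤ< N (λ _ → + 0) ≡ + 0
  Σℤ<-zero zero    = refl
  Σℤ<-zero (suc N) = trans (ZP.+-identityˡ _) (Σℤ<-zero N)

  Σℤ<-split : ∀ N d f → Σℤ< (N N.+ d) f ≡ Σℤ< N f + Σℤ< d (λ k → f (N N.+ k))
  Σℤ<-split zero    d f = sym (ZP.+-identityˡ _)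
  Σℤ<-split (suc N) d f = trans (cong (λ z → f 0 + z) (Σℤ<-split N d (λ k → f (suc k))))
    (sym (ZP.+-assoc (f 0) (Σℤ< N (λ k → f (suc k))) _))

  Σℤ<-snoc : ∀ N f → Σℤ< (suc N) f ≡ Σℤ< N f + f N
  Σℤ<-snoc N f = begin
    Σℤ< (suc N) f                        ≡⟨ cong (λ z → Σℤ< z f) (NP.+-comm 1 N) ⟩
    Σℤ< (N N.+ 1) f                      ≡⟨ Σℤ<-split N 1 f ⟩
    Σℤ< N f + (f (N N.+ 0) + + 0)        ≡⟨ cong (λ z → Σℤ< N f + z) (trans (ZP.+-identityʳ _) (cong f (NP.+-identityʳ N))) ⟩
    Σℤ< N f + f N                        ∎

  Σℤ<-extend : ∀ N M f → N ≤ M → (∀ k → N ≤ k → f k ≡ + 0) → Σℤ< M f ≡ Σℤ< N f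
  Σℤ<-extend N M f le vanish = begin
    Σℤ< M f                                     ≡⟨ cong (λ x → Σℤ< x f) (sym (NP.m+[n∸m]≡n le)) ⟩
    Σℤ< (N N.+ (M N.∸ N)) f                     ≡⟨ Σℤ<-split N (M N.∸ N) f ⟩
    Σℤ< N f + Σℤ< (M N.∸ N) (λ k → f (N N.+ k))  ≡⟨ cong (λ z → Σℤ< N f + z) tail ⟩
    Σℤ< N f + + 0                               ≡⟨ ZP.+-identityʳ (Σℤ< N f) ⟩
    Σℤ< N f                                     ∎
    where
    tail = trans (Σℤ<-cong (M N.∸ N) (λ k → vanish (N N.+ k) (NP.m≤m+n N k))) (Σℤ<-zero (M N.∸ N))

  T-add : ∀ n f g s → T n (λ t → f t + g t) s ≡ T n f s + T n g s
  T-add n f g zero          = at₀ (+ (2 N.+ n) - + 0) (f 1) (g 1) (f 0) (g 0)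
    where
    at₀ : ∀ c f₁ g₁ f₀ g₀ → + 1 * ((f₁ + g₁) + + 0) + c * ((f₀ + g₀) + + 0)
      ≡ (+ 1 * (f₁ + + 0) + c * (f₀ + + 0)) + (+ 1 * (g₁ + + 0) + c * (g₀ + + 0))
    at₀ = solve-∀
  T-add n f g (suc zero)    = at₁ (+ (2 N.+ n) - + 1) (f 2) (g 2) (f 0) (g 0) (f 1) (g 1)
    where
    at₁ : ∀ c f₂ g₂ f₀ g₀ f₁ g₁ → + 2 * ((f₂ + g₂) + (f₀ + g₀)) + c * ((f₁ + g₁) + + 0)
      ≡ (+ 2 * (f₂ + f₀) + c * (f₁ + + 0)) + (+ 2 * (g₂ + g₀) + c * (g₁ + + 0))
    at₁ = solve-∀
  T-add n f g (suc (suc s)) = at₂₊ (+ suc (suc (suc s))) (+ (2 N.+ n) - + suc (suc s))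
    (f (3 N.+ s)) (g (3 N.+ s)) (f (1 N.+ s)) (g (1 N.+ s)) (f (2 N.+ s)) (g (2 N.+ s)) (f s) (g s)
    where
    at₂₊ : ∀ c c' fa ga fb gb fc gc fd gd → c * ((fa + ga) + (fb + gb)) + c' * ((fc + gc) + (fd + gd))
      ≡ (c * (fa + fb) + c' * (fc + fd)) + (c * (ga + gb) + c' * (gc + gd))
    at₂₊ = solve-∀

  T-scale : ∀ n c f s → T n (λ t → c * f t) s ≡ c * T n f s
  T-scale n c f zero          = at₀ c (+ (2 N.+ n) - + 0) (f 1) (f 0)
    where
    at₀ : ∀ c c' f₁ f₀ → + 1 * (c * f₁ + + 0) + c' * (c * f₀ + + 0) ≡ c * (+ 1 * (f₁ + + 0) + c' * (f₀ + + 0))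
    at₀ = solve-∀
  T-scale n c f (suc zero)    = at₁ c (+ 2) (+ (2 N.+ n) - + 1) (f 2) (f 0) (f 1)
    where
    at₁ : ∀ c a b fa fb fc → a * (c * fa + c * fb) + b * (c * fc + + 0) ≡ c * (a * (fa + fb) + b * (fc + + 0))
    at₁ = solve-∀
  T-scale n c f (suc (suc s)) = at₂₊ c (+ suc (suc (suc s))) (+ (2 N.+ n) - + suc (suc s))
                                     (f (3 N.+ s)) (f (1 N.+ s)) (f (2 N.+ s)) (f s)
    where
    at₂₊ : ∀ c a b fa fb fc fd → a * (c * fa + c * fb) + b * (c * fc + c * fd) ≡ c * (a * (fa + fb) + b * (fc + fd))
    at₂₊ = solve-∀

  T-zero : ∀ n s → T n (λ _ → + 0) s ≡ + 0
  T-zero n s = begin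
    T n (λ _ → + 0) s                                  ≡⟨ cong₂ (λ x y → + suc s * (+ 0 + x) + c * (+ 0 + y))
                                                               (shift-zero s) (trans (shift-cong shift-zero s) (shift-zero s)) ⟩
    + suc s * (+ 0 + + 0) + c * (+ 0 + + 0)            ≡⟨ vanish (+ suc s) c ⟩
    + 0                                                ∎
    where
    c = + (2 N.+ n) - + s
    vanish : ∀ a b → a * (+ 0 + + 0) + b * (+ 0 + + 0) ≡ + 0
    vanish = solve-∀

  T-Σℤ< : ∀ n N h s → T n (λ t → Σℤ< N (λ k → h k t)) s ≡ Σℤ< N (λ k → T n (h k) s)
  T-Σℤ< n zero    h s = T-zero n s
  T-Σℤ< n (suc N) h s = trans (T-add n (h 0) (λ t → Σℤ< N (λ k → h (suc k) t)) s)
    (cong (λ z → T n (h 0) s + z) (T-Σℤ< n N (λ k → h (suc k)) s))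

  jp : ℕ → ℕ → ℤ
  jp n j = + j * pcoef n j

  weight : ℕ → ℕ → ℤ
  weight n k = jp n (suc n N.∸ 2 N.* k)

  pcoef-degree : ∀ n j → suc n < j → pcoef n j ≡ + 0
  pcoef-degree zero    (suc zero)    (s≤s ())
  pcoef-degree zero    (suc (suc j)) _ = refl
  pcoef-degree (suc n) (suc (suc j)) (s≤s (s≤s lt)) = begin
    + suc (suc (suc j)) * pcoef n (suc (suc (suc j))) + + suc j * pcoef n (suc j)
      ≡⟨ cong₂ (λ x y → + suc (suc (suc j)) * x + + suc j * y)
               (pcoef-degree n (suc (suc (suc j))) (s≤s (NP.≤-trans lt (NP.≤-trans (NP.n≤1+n j) (NP.n≤1+n (suc j))))))
               (pcoef-degree n (suc j) (s≤s lt)) ⟩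
    + suc (suc (suc j)) * + 0 + + suc j * + 0
      ≡⟨ cong₂ _+_ (ZP.*-zeroʳ (+ suc (suc (suc j)))) (ZP.*-zeroʳ (+ suc j)) ⟩
    + 0 ∎

  weight-vanishes : ∀ n k → suc n ≤ 2 N.* k → weight n k ≡ + 0
  weight-vanishes n k le = cong (λ z → + z * pcoef n z) (NP.m≤n⇒m∸n≡0 le)

  zero-factor : ∀ {a} x y → a ≡ + 0 → a * x ≡ a * y
  zero-factor x y refl = trans (ZP.*-zeroˡ x) (sym (ZP.*-zeroˡ y))

  two-suc : ∀ k → 2 N.* suc k ≡ suc (suc (2 N.* k))
  two-suc k = NP.*-suc 2 k

  -- Recurrences for the weights, from p(n+1,j) = (j+1) p(n,j+1) + (j-1) p(n,j-1):
  --   q(n+1,0) = (n+2) q(n,0)   and   q(n+1,k+1) = (n-2k) (q(n,k+1) + q(n,k)).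
  weight-rec₀ : ∀ n → weight (suc n) 0 ≡ + (2 N.+ n) * weight n 0
  weight-rec₀ n = begin
    + (2 N.+ n) * (+ (3 N.+ n) * pcoef n (3 N.+ n) + + suc n * pcoef n (suc n))
      ≡⟨ cong (λ z → + (2 N.+ n) * (+ (3 N.+ n) * z + + suc n * pcoef n (suc n)))
              (pcoef-degree n (3 N.+ n) (s≤s (NP.n≤1+n (suc n)))) ⟩
    + (2 N.+ n) * (+ (3 N.+ n) * + 0 + + suc n * pcoef n (suc n))
      ≡⟨ drop-top (+ (2 N.+ n)) (+ (3 N.+ n)) (+ suc n) (pcoef n (suc n)) ⟩
    + (2 N.+ n) * (+ suc n * pcoef n (suc n)) ∎
    where
    drop-top : ∀ A B x y → A * (B * + 0 + x * y) ≡ A * (x * y)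
    drop-top = solve-∀

  jp-rec : ∀ n j → + j * pcoef (suc n) j ≡ + j * (jp n (j N.∸ 1) + jp n (suc j))
  jp-rec n zero          = at₀ (pcoef (suc n) 0) (jp n 0) (jp n 1)
    where
    at₀ : ∀ x y z → + 0 * x ≡ + 0 * (y + z)
    at₀ = solve-∀
  jp-rec n (suc zero)    = at₁ (pcoef n 2) (pcoef n 0)
    where
    at₁ : ∀ a b → + 1 * (+ 2 * a + + 0) ≡ + 1 * (+ 0 * b + + 2 * a)
    at₁ = solve-∀
  jp-rec n (suc (suc j)) = at₂₊ (+ j) (pcoef n (3 N.+ j)) (pcoef n (suc j))
    where
    at₂₊ : ∀ J a b → (+ 2 + J) * ((+ 3 + J) * a + (+ 1 + J) * b) ≡ (+ 2 + J) * ((+ 1 + J) * b + (+ 3 + J) * a)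
    at₂₊ = solve-∀

  weight-rec : ∀ n k → weight (suc n) (suc k) ≡ + (n N.∸ 2 N.* k) * (weight n (suc k) + weight n k)
  weight-rec n k with 2 N.* k ≤? n
  ... | yes le = begin
    jp (suc n) (suc (suc n) N.∸ 2 N.* suc k)   ≡⟨ cong (λ z → jp (suc n) (suc (suc n) N.∸ z)) (two-suc k) ⟩
    jp (suc n) j                               ≡⟨ jp-rec n j ⟩
    + j * (jp n (j N.∸ 1) + jp n (suc j))      ≡⟨ cong₂ (λ x y → + j * (jp n x + jp n y)) below above ⟩
    + j * (weight n (suc k) + weight n k)      ∎
    where
    j = n N.∸ 2 N.* k
    below : j N.∸ 1 ≡ suc n N.∸ 2 N.* suc k
    below = trans (NP.∸-+-assoc n (2 N.* k) 1) (trans (cong (n N.∸_) (NP.+-comm (2 N.* k) 1))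
            (sym (cong (suc n N.∸_) (two-suc k))))
    above : suc j ≡ suc n N.∸ 2 N.* k
    above = sym (NP.+-∸-assoc 1 le)
  ... | no nle = begin
    jp (suc n) (suc (suc n) N.∸ 2 N.* suc k)   ≡⟨ cong (λ z → jp (suc n) (suc (suc n) N.∸ z)) (two-suc k) ⟩
    jp (suc n) (n N.∸ 2 N.* k)                 ≡⟨ cong (jp (suc n)) j≡0 ⟩
    + 0 * pcoef (suc n) 0                      ≡⟨ zero-factor (pcoef (suc n) 0) (weight n (suc k) + weight n k) refl ⟩
    + 0 * (weight n (suc k) + weight n k)      ≡⟨ cong (λ z → + z * (weight n (suc k) + weight n k)) (sym j≡0) ⟩
    + (n N.∸ 2 N.* k) * (weight n (suc k) + weight n k) ∎
    where
    j≡0 : n N.∸ 2 N.* k ≡ 0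
    j≡0 = NP.m≤n⇒m∸n≡0 (NP.≤-trans (NP.n≤1+n n) (NP.≰⇒> nle))

  -- The right-hand side as a sequence in s, summed over k < n+2 (the extra terms vanish).
  R : ℕ → Seq
  R n s = Σℤ< (n N.+ 2) (λ k → weight n k * mixedPow (2 N.* k) (n N.∸ 2 N.* k) s)

  -- Each summand of R n is mapped by T n according to T-mixedPow (when 2k > n the weight is 0).
  weight-T-mixedPow : ∀ n k s → weight n k * T n (mixedPow (2 N.* k) (n N.∸ 2 N.* k)) s
    ≡ weight n k * (+ (2 N.+ (n N.∸ 2 N.* k)) * mixedPow (2 N.* k) (suc (n N.∸ 2 N.* k)) s
                  + + (n N.∸ 2 N.* k) * mixedPow (2 N.+ 2 N.* k) ((n N.∸ 2 N.* k) N.∸ 1) s)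
  weight-T-mixedPow n k s with 2 N.* k ≤? n
  ... | yes le = cong (weight n k *_)
    (trans (cong (λ m → T m (mixedPow (2 N.* k) (n N.∸ 2 N.* k)) s) (sym (NP.m+[n∸m]≡n le)))
           (T-mixedPow (2 N.* k) (n N.∸ 2 N.* k) s))
  ... | no nle = zero-factor (T n (mixedPow (2 N.* k) (n N.∸ 2 N.* k)) s) _ (weight-vanishes n k (NP.≰⇒> nle))

  -- The two families of terms into which both R (n+1) and T n (R n) split:
  -- "grow" raises the power of 1+x, "trade" turns (1+x)² into (1-x)².
  module _ (n s : ℕ) where

    grow trade : ℕ → ℤ
    grow  k = weight n k * (+ (2 N.+ (n N.∸ 2 N.* k)) * mixedPow (2 N.* k) (suc (n N.∸ 2 N.* k)) s)
    trade k = weight n k * (+ (n N.∸ 2 N.* k) * mixedPow (2 N.+ 2 N.* k) ((n N.∸ 2 N.* k) N.∸ 1) s)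

    private
      reassoc : ∀ c q x → c * q * x ≡ q * (c * x)
      reassoc = solve-∀

    -- The same terms written with the factor n+2-2k produced by the weight recurrence.
    grow-alt : ∀ k → + (suc (suc n) N.∸ 2 N.* k) * weight n k * mixedPow (2 N.* k) (suc n N.∸ 2 N.* k) s ≡ grow k
    grow-alt k with 2 N.* k ≤? n
    ... | yes le = trans (cong₂ (λ x y → + x * weight n k * mixedPow (2 N.* k) y s) (NP.+-∸-assoc 2 le) (NP.+-∸-assoc 1 le))
                         (reassoc (+ (2 N.+ (n N.∸ 2 N.* k))) (weight n k) (mixedPow (2 N.* k) (suc (n N.∸ 2 N.* k)) s))
    ... | no nle = begin
      + (suc (suc n) N.∸ 2 N.* k) * weight n k * mixedPow (2 N.* k) (suc n N.∸ 2 N.* k) s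
        ≡⟨ reassoc (+ (suc (suc n) N.∸ 2 N.* k)) (weight n k) (mixedPow (2 N.* k) (suc n N.∸ 2 N.* k) s) ⟩
      weight n k * (+ (suc (suc n) N.∸ 2 N.* k) * mixedPow (2 N.* k) (suc n N.∸ 2 N.* k) s)
        ≡⟨ zero-factor (+ (suc (suc n) N.∸ 2 N.* k) * mixedPow (2 N.* k) (suc n N.∸ 2 N.* k) s)
                       (+ (2 N.+ (n N.∸ 2 N.* k)) * mixedPow (2 N.* k) (suc (n N.∸ 2 N.* k)) s)
                       (weight-vanishes n k (NP.≰⇒> nle)) ⟩
      grow k ∎

    trade-alt : ∀ k → + (n N.∸ 2 N.* k) * weight n k * mixedPow (2 N.* suc k) (suc n N.∸ 2 N.* suc k) s ≡ trade k
    trade-alt k = trans (cong₂ (λ x y → + (n N.∸ 2 N.* k) * weight n k * mixedPow x y s) (two-suc k) index)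
                        (reassoc (+ (n N.∸ 2 N.* k)) (weight n k) (mixedPow (2 N.+ 2 N.* k) ((n N.∸ 2 N.* k) N.∸ 1) s))
      where
      index : suc n N.∸ 2 N.* suc k ≡ (n N.∸ 2 N.* k) N.∸ 1
      index = trans (cong (suc n N.∸_) (two-suc k))
              (sym (trans (NP.∸-+-assoc n (2 N.* k) 1) (cong (n N.∸_) (NP.+-comm (2 N.* k) 1))))

    R-suc : R (suc n) s ≡ Σℤ< (n N.+ 2) grow + Σℤ< (n N.+ 2) trade
    R-suc = begin
      Σℤ< (suc (n N.+ 2)) F                                   ≡⟨ cong₂ _+_ F-zero (Σℤ<-cong (n N.+ 2) F-suc) ⟩
      grow 0 + Σℤ< (n N.+ 2) (λ k → grow (suc k) + trade k)    ≡⟨ cong (λ z → grow 0 + z) (Σℤ<-add (n N.+ 2) (λ k → grow (suc k)) trade) ⟩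
      grow 0 + (Σℤ< (n N.+ 2) (λ k → grow (suc k)) + Σℤ< (n N.+ 2) trade)
                                                              ≡⟨ sym (ZP.+-assoc (grow 0) _ _) ⟩
      Σℤ< (suc (n N.+ 2)) grow + Σℤ< (n N.+ 2) trade           ≡⟨ cong (_+ Σℤ< (n N.+ 2) trade) (Σℤ<-snoc (n N.+ 2) grow) ⟩
      (Σℤ< (n N.+ 2) grow + grow (n N.+ 2)) + Σℤ< (n N.+ 2) trade
                                                              ≡⟨ cong (λ z → (Σℤ< (n N.+ 2) grow + z) + Σℤ< (n N.+ 2) trade) grow-last ⟩
      (Σℤ< (n N.+ 2) grow + + 0) + Σℤ< (n N.+ 2) trade          ≡⟨ cong (_+ Σℤ< (n N.+ 2) trade) (ZP.+-identityʳ (Σℤ< (n N.+ 2) grow)) ⟩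
      Σℤ< (n N.+ 2) grow + Σℤ< (n N.+ 2) trade ∎
      where
      F : ℕ → ℤ
      F k = weight (suc n) k * mixedPow (2 N.* k) (suc n N.∸ 2 N.* k) s
      F-zero : F 0 ≡ grow 0
      F-zero = trans (cong (_* mixedPow 0 (suc n) s) (weight-rec₀ n)) (grow-alt 0)
      F-suc : ∀ k → F (suc k) ≡ grow (suc k) + trade k
      F-suc k = begin
        weight (suc n) (suc k) * X                                          ≡⟨ cong (_* X) (weight-rec n k) ⟩
        + (n N.∸ 2 N.* k) * (weight n (suc k) + weight n k) * X             ≡⟨ distrib (+ (n N.∸ 2 N.* k)) (weight n (suc k)) (weight n k) X ⟩
        + (n N.∸ 2 N.* k) * weight n (suc k) * X + + (n N.∸ 2 N.* k) * weight n k * X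
                                                                            ≡⟨ cong₂ _+_ first (trade-alt k) ⟩
        grow (suc k) + trade k                                              ∎
        where
        X = mixedPow (2 N.* suc k) (suc n N.∸ 2 N.* suc k) s
        distrib : ∀ c q₁ q₀ x → c * (q₁ + q₀) * x ≡ c * q₁ * x + c * q₀ * x
        distrib = solve-∀
        first : + (n N.∸ 2 N.* k) * weight n (suc k) * X ≡ grow (suc k)
        first = trans (cong (λ z → + z * weight n (suc k) * X) (sym (cong (suc (suc n) N.∸_) (two-suc k))))
                      (grow-alt (suc k))
      grow-last : grow (n N.+ 2) ≡ + 0
      grow-last = trans (zero-factor _ (+ 0) (weight-vanishes n (n N.+ 2) le)) (ZP.*-zeroʳ (weight n (n N.+ 2)))
        where
        le : suc n ≤ 2 N.* (n N.+ 2)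
        le = NP.≤-trans (NP.≤-trans (NP.n≤1+n (suc n)) (NP.≤-reflexive (NP.+-comm 2 n))) (NP.m≤n*m (n N.+ 2) 2)

    T-R : T n (R n) s ≡ Σℤ< (n N.+ 2) (λ k → grow k + trade k)
    T-R = begin
      T n (R n) s                 ≡⟨ T-Σℤ< n (n N.+ 2) (λ k t → weight n k * mixedPow (2 N.* k) (n N.∸ 2 N.* k) t) s ⟩
      Σℤ< (n N.+ 2) (λ k → T n (λ t → weight n k * mixedPow (2 N.* k) (n N.∸ 2 N.* k) t) s)
                                  ≡⟨ Σℤ<-cong (n N.+ 2) (λ k → T-scale n (weight n k) (mixedPow (2 N.* k) (n N.∸ 2 N.* k)) s) ⟩
      Σℤ< (n N.+ 2) (λ k → weight n k * T n (mixedPow (2 N.* k) (n N.∸ 2 N.* k)) s)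
                                  ≡⟨ Σℤ<-cong (n N.+ 2) (λ k → trans (weight-T-mixedPow n k s) (ZP.*-distribˡ-+ (weight n k) _ _)) ⟩
      Σℤ< (n N.+ 2) (λ k → grow k + trade k) ∎

  R-rec : ∀ n s → R (suc n) s ≡ T n (R n) s
  R-rec n s = trans (R-suc n s) (sym (trans (T-R n s) (Σℤ<-add (n N.+ 2) (grow n s) (trade n s))))

  rhsTerm≡ : ∀ n s k → rhsTerm n s k ≡ weight n k * mixedPow (2 N.* k) (n N.∸ 2 N.* k) s
  rhsTerm≡ n s k = trans (sym (ZP.*-assoc (+ j) (p n j) (E n k s)))
    (cong₂ (λ x y → + j * x * y) (coeff-P n j) (E≡mixedPow n k s))
    where j = suc n N.∸ 2 N.* k

  -- The summation bound ⌊(n+1)/2⌋ + 1 of the theorem covers all non-zero weights.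
  div-bound : ∀ m → m < 2 N.* suc (m / 2)
  div-bound m = subst (_< 2 N.* suc (m / 2)) (sym (m≡m%n+[m/n]*n m 2))
    (NP.<-≤-trans (NP.+-monoˡ-< ((m / 2) N.* 2) (m%n<n m 2))
      (NP.≤-reflexive (trans (cong (2 N.+_) (NP.*-comm (m / 2) 2)) (sym (NP.*-suc 2 (m / 2))))))

  rhsSum≡R : ∀ n s → rhsSum n s ≡ R n s
  rhsSum≡R n s = begin
    rhsSum n s                 ≡⟨ sumℤ-applyUpTo (rhsTerm n s) (λ k → k) K ⟩
    Σℤ< K (rhsTerm n s)        ≡⟨ Σℤ<-cong K (rhsTerm≡ n s) ⟩
    Σℤ< K term                 ≡⟨ sym (Σℤ<-extend K (n N.+ 2) term K≤n+2 tail-vanishes) ⟩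
    R n s                      ∎
    where
    K = suc (suc n / 2)
    term : ℕ → ℤ
    term k = weight n k * mixedPow (2 N.* k) (n N.∸ 2 N.* k) s
    K≤n+2 : K ≤ n N.+ 2
    K≤n+2 = NP.≤-trans (s≤s (m/n≤m (suc n) 2)) (NP.≤-reflexive (NP.+-comm 2 n))
    tail-vanishes : ∀ k → K ≤ k → term k ≡ + 0
    tail-vanishes k le = trans (cong (_* mixedPow (2 N.* k) (n N.∸ 2 N.* k) s)
       (weight-vanishes n k (NP.<⇒≤ (NP.<-≤-trans (div-bound (suc n)) (NP.*-monoʳ-≤ 2 le)))))
       (ZP.*-zeroˡ (mixedPow (2 N.* k) (n N.∸ 2 N.* k) s))

module Counting where

  open import Defs
  open import Data.Nat as N using (ℕ; zero; suc; _+_; _∸_; _*_; _≤_; _<_; z≤n; s≤s; _<ᵇ_; _≡ᵇ_)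
  import Data.Nat.Properties as NP
  open import Algebra.Properties.CommutativeSemigroup NP.+-commutativeSemigroup using () renaming (interchange to +-interchange)
  open import Data.Nat.ListAction using (sum)
  open import Data.Nat.ListAction.Properties using (sum-↭; sum-++)
  open import Data.Nat.Tactic.RingSolver using (solve-∀)
  open import Data.Bool using (Bool; true; false; if_then_else_; T; not)
  open import Data.Bool.Properties using (T-≡)
  open import Data.Unit using (tt)
  open import Data.Empty using (⊥-elim)
  open import Data.Product using (∃; ∃₂; _×_; _,_; proj₁; proj₂)
  open import Data.List using (List; []; _∷_; _++_; map; concatMap; length; filterᵇ; upTo; take; drop)
  import Data.List.Properties as LP
  open import Data.List.Membership.Propositional using (_∈_; _∉_)
  open import Data.List.Membership.Propositional.Properties
  open import Data.List.Membership.Propositional.Properties.WithK using (unique∧set⇒bag)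
  open import Data.List.Relation.Unary.Any using (here; there)
  open import Data.List.Relation.Unary.All as All using (All; []; _∷_)
  import Data.List.Relation.Unary.All.Properties as AllP
  open import Data.List.Relation.Unary.AllPairs using (AllPairs; []; _∷_)
  import Data.List.Relation.Unary.AllPairs.Properties as APP
  open import Data.List.Relation.Unary.Unique.Propositional using (Unique)
  import Data.List.Relation.Unary.Unique.Propositional.Properties as UP
  open import Data.List.Relation.Binary.Permutation.Propositional using (_↭_; ↭-sym; ↭-trans; ↭-refl; ↭-prep; ↭-swap; ↭-reflexive; ↭⇒↭ₛ)
  open import Data.List.Relation.Binary.Permutation.Propositional.Properties using (map⁺; ∈-resp-↭; drop-mid; ↭-empty-inv; ↭-length; ++⁺ˡ)
  import Data.List.Relation.Binary.Permutation.Setoid.Properties as PSP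
  open import Data.List.Relation.Binary.Disjoint.Propositional using (Disjoint)
  open import Data.List.Relation.Binary.BagAndSetEquality using (∼bag⇒↭)
  open import Function using (_∘_; mk⇔; Equivalence)
  open import Relation.Binary.PropositionalEquality
  open import Relation.Binary.Definitions using (tri<; tri≈; tri>)
  open import Relation.Nullary using (¬_; yes; no)

  ΣL : {A : Set} → List A → (A → ℕ) → ℕ
  ΣL xs f = sum (map f xs)

  ΣL-↭ : {A : Set} {xs ys : List A} (f : A → ℕ) → xs ↭ ys → ΣL xs f ≡ ΣL ys f
  ΣL-↭ f p = sum-↭ (map⁺ f p)

  ΣL-++ : {A : Set} (xs ys : List A) (f : A → ℕ) → ΣL (xs ++ ys) f ≡ ΣL xs f + ΣL ys f
  ΣL-++ xs ys f = trans (cong sum (LP.map-++ f xs ys)) (sum-++ (map f xs) (map f ys))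

  ΣL-map : {A B : Set} (g : A → B) (xs : List A) (f : B → ℕ) → ΣL (map g xs) f ≡ ΣL xs (f ∘ g)
  ΣL-map g xs f = cong sum (sym (LP.map-∘ xs))

  ΣL-concatMap : {A B : Set} (g : A → List B) (xs : List A) (f : B → ℕ) →
    ΣL (concatMap g xs) f ≡ ΣL xs (λ x → ΣL (g x) f)
  ΣL-concatMap g []       f = refl
  ΣL-concatMap g (x ∷ xs) f = trans (ΣL-++ (g x) (concatMap g xs) f) (cong (ΣL (g x) f +_) (ΣL-concatMap g xs f))

  ΣL-cong : {A : Set} (xs : List A) {f g : A → ℕ} → (∀ {x} → x ∈ xs → f x ≡ g x) → ΣL xs f ≡ ΣL xs g
  ΣL-cong []       e = refl
  ΣL-cong (x ∷ xs) e = cong₂ _+_ (e (here refl)) (ΣL-cong xs (e ∘ there))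

  ΣL-add : {A : Set} (xs : List A) (f g : A → ℕ) → ΣL xs (λ x → f x + g x) ≡ ΣL xs f + ΣL xs g
  ΣL-add []       f g = refl
  ΣL-add (x ∷ xs) f g = trans (cong (f x + g x +_) (ΣL-add xs f g)) (+-interchange (f x) (g x) (ΣL xs f) (ΣL xs g))

  ΣL-mul : ∀ {A : Set} (xs : List A) c (f : A → ℕ) → ΣL xs (λ x → c * f x) ≡ c * ΣL xs f
  ΣL-mul []       c f = sym (NP.*-zeroʳ c)
  ΣL-mul (x ∷ xs) c f = trans (cong (c * f x +_) (ΣL-mul xs c f)) (sym (NP.*-distribˡ-+ c (f x) _))

  ΣL-zero : {A : Set} (xs : List A) (f : A → ℕ) → (∀ {x} → x ∈ xs → f x ≡ 0) → ΣL xs f ≡ 0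
  ΣL-zero []       f z = refl
  ΣL-zero (x ∷ xs) f z = cong₂ _+_ (z (here refl)) (ΣL-zero xs f (z ∘ there))

  Σ< : ℕ → (ℕ → ℕ) → ℕ
  Σ< zero    f = 0
  Σ< (suc N) f = f 0 + Σ< N (λ k → f (suc k))

  Σ<-cong : ∀ N {f g} → (∀ k → f k ≡ g k) → Σ< N f ≡ Σ< N g
  Σ<-cong zero    e = refl
  Σ<-cong (suc N) e = cong₂ _+_ (e 0) (Σ<-cong N (λ k → e (suc k)))

  Σ<-cong< : ∀ N {f g} → (∀ k → k < N → f k ≡ g k) → Σ< N f ≡ Σ< N g
  Σ<-cong< zero    e = refl
  Σ<-cong< (suc N) e = cong₂ _+_ (e 0 (s≤s z≤n)) (Σ<-cong< N (λ k k<N → e (suc k) (s≤s k<N)))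

  Σ<-add : ∀ N f g → Σ< N (λ k → f k + g k) ≡ Σ< N f + Σ< N g
  Σ<-add zero    f g = refl
  Σ<-add (suc N) f g = trans (cong (f 0 + g 0 +_) (Σ<-add N (λ k → f (suc k)) (λ k → g (suc k))))
    (+-interchange (f 0) (g 0) (Σ< N (λ k → f (suc k))) (Σ< N (λ k → g (suc k))))

  Σ<-snoc : ∀ N f → Σ< (suc N) f ≡ Σ< N f + f N
  Σ<-snoc zero    f = NP.+-identityʳ (f 0)
  Σ<-snoc (suc N) f = trans (cong (f 0 +_) (Σ<-snoc N (λ k → f (suc k)))) (sym (NP.+-assoc (f 0) _ _))

  Σ<-const : ∀ N c → Σ< N (λ _ → c) ≡ N * c
  Σ<-const zero    c = refl
  Σ<-const (suc N) c = cong (c +_) (Σ<-const N c)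

  Σ<-mul : ∀ N c f → Σ< N (λ k → c * f k) ≡ c * Σ< N f
  Σ<-mul zero    c f = sym (NP.*-zeroʳ c)
  Σ<-mul (suc N) c f = trans (cong (c * f 0 +_) (Σ<-mul N c (λ k → f (suc k)))) (sym (NP.*-distribˡ-+ c (f 0) _))

  Σ<-complement : ∀ N (e : ℕ → ℕ) d → (∀ t → e t ≤ 1) → Σ< N e ≡ d → Σ< N (λ t → 1 ∸ e t) ≡ N ∸ d
  Σ<-complement N e d le se = begin
    Σ< N (λ t → 1 ∸ e t)                 ≡⟨ sym (NP.m+n∸n≡m _ d) ⟩
    Σ< N (λ t → 1 ∸ e t) + d ∸ d         ≡⟨ cong (λ z → Σ< N (λ t → 1 ∸ e t) + z ∸ d) (sym se) ⟩
    Σ< N (λ t → 1 ∸ e t) + Σ< N e ∸ d    ≡⟨ cong (_∸ d) (sym (Σ<-add N (λ t → 1 ∸ e t) e)) ⟩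
    Σ< N (λ t → 1 ∸ e t + e t) ∸ d       ≡⟨ cong (_∸ d) (Σ<-cong N (λ t → NP.m∸n+n≡m (le t))) ⟩
    Σ< N (λ _ → 1) ∸ d                   ≡⟨ cong (_∸ d) (trans (Σ<-const N 1) (NP.*-identityʳ N)) ⟩
    N ∸ d                                ∎
    where open ≡-Reasoning

  ΣL-Σ< : ∀ {A : Set} (xs : List A) N (g : A → ℕ → ℕ) → ΣL xs (λ x → Σ< N (g x)) ≡ Σ< N (λ j → ΣL xs (λ x → g x j))
  ΣL-Σ< []       N g = sym (trans (Σ<-const N 0) (NP.*-zeroʳ N))
  ΣL-Σ< (x ∷ xs) N g = trans (cong (Σ< N (g x) +_) (ΣL-Σ< xs N g)) (sym (Σ<-add N (g x) (λ j → ΣL xs (λ y → g y j))))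

  map-unique-injectiveOn : {A : Set} {xs : List A} (φ : A → A) → Unique xs →
    (∀ {x y} → x ∈ xs → y ∈ xs → φ x ≡ φ y → x ≡ y) → Unique (map φ xs)
  map-unique-injectiveOn {xs = []} φ u inj = []
  map-unique-injectiveOn {xs = x ∷ xs} φ (px ∷ u) inj =
    AllP.map⁺ (All.tabulate (λ {y} y∈ eq → All.lookup px y∈ (inj (here refl) (there y∈) eq)))
    ∷ map-unique-injectiveOn φ u (λ a b e → inj (there a) (there b) e)

  -- An involution of the elements of a duplicate-free list permutes the list; this is how
  -- all re-indexings of sums over 𝔖_m below are justified.
  involution-↭ : {A : Set} {xs : List A} (φ : A → A) → Unique xs →
    (∀ {x} → x ∈ xs → φ x ∈ xs) → (∀ {x} → x ∈ xs → φ (φ x) ≡ x) → map φ xs ↭ xs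
  involution-↭ {xs = xs} φ u clo inv = ∼bag⇒↭ (unique∧set⇒bag (map-unique-injectiveOn φ u inj) u (mk⇔ to from))
    where
    inj : ∀ {x y} → x ∈ xs → y ∈ xs → φ x ≡ φ y → x ≡ y
    inj {x} {y} a b e = trans (sym (inv a)) (trans (cong φ e) (inv b))
    to : ∀ {x} → x ∈ map φ xs → x ∈ xs
    to p with ∈-map⁻ φ p
    ... | z , z∈ , refl = clo z∈
    from : ∀ {x} → x ∈ xs → x ∈ map φ xs
    from {x} p = subst (_∈ map φ xs) (inv p) (∈-map⁺ φ (clo p))

  insertions-↭ : ∀ x ys {w} → w ∈ insertions x ys → w ↭ x ∷ ys
  insertions-↭ x [] (here refl) = ↭-refl
  insertions-↭ x (y ∷ ys) (here refl) = ↭-refl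
  insertions-↭ x (y ∷ ys) (there p) with ∈-map⁻ (y ∷_) p
  ... | w' , w'∈ , refl = ↭-trans (↭-prep y (insertions-↭ x ys w'∈)) (↭-swap y x ↭-refl)

  insertions-∈ : ∀ x a b → a ++ x ∷ b ∈ insertions x (a ++ b)
  insertions-∈ x [] [] = here refl
  insertions-∈ x [] (y ∷ b) = here refl
  insertions-∈ x (y ∷ a) b = there (∈-map⁺ (y ∷_) (insertions-∈ x a b))

  perms-↭ : ∀ xs {w} → w ∈ perms xs → w ↭ xs
  perms-↭ [] (here refl) = ↭-refl
  perms-↭ (x ∷ xs) {w} p with ∈-concat⁻′ (map (insertions x) (perms xs)) p
  ... | vs , w∈vs , vs∈ with ∈-map⁻ (insertions x) vs∈
  ... | v , v∈ , refl = ↭-trans (insertions-↭ x v w∈vs) (↭-prep x (perms-↭ xs v∈))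

  ↭-perms : ∀ xs {w} → w ↭ xs → w ∈ perms xs
  ↭-perms [] p with ↭-empty-inv p
  ... | refl = here refl
  ↭-perms (x ∷ xs) {w} p with ∈-∃++ (∈-resp-↭ (↭-sym p) (here refl))
  ... | a , b , refl = ∈-concat⁺′ (insertions-∈ x a b) (∈-map⁺ (insertions x) (↭-perms xs ab))
    where
    ab : a ++ b ↭ xs
    ab = drop-mid a [] p

  -- Deleting x undoes any insertion of a fresh x; hence insertions of x into
  -- different lists never coincide.
  delete : ℕ → List ℕ → List ℕ
  delete x [] = []
  delete x (y ∷ w) with x N.≟ y
  ... | yes _ = w
  ... | no _ = y ∷ delete x w

  delete-head : ∀ x w → delete x (x ∷ w) ≡ w
  delete-head x w with x N.≟ x
  ... | yes _ = refl
  ... | no ne = ⊥-elim (ne refl)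

  delete-insertions : ∀ x ys {w} → w ∈ insertions x ys → x ∉ ys → delete x w ≡ ys
  delete-insertions x [] (here refl) nx = delete-head x []
  delete-insertions x (y ∷ ys) (here refl) nx = delete-head x (y ∷ ys)
  delete-insertions x (y ∷ ys) (there p) nx with ∈-map⁻ (y ∷_) p
  ... | w' , w'∈ , refl with x N.≟ y
  ... | yes refl = ⊥-elim (nx (here refl))
  ... | no _ = cong (y ∷_) (delete-insertions x ys w'∈ (nx ∘ there))

  insertions-unique : ∀ x ys → x ∉ ys → Unique (insertions x ys)
  insertions-unique x [] nx = [] ∷ []
  insertions-unique x (y ∷ ys) nx =
    All.tabulate (λ {w} w∈ → hd w∈) ∷ UP.map⁺ (λ { refl → refl }) (insertions-unique x ys (nx ∘ there))
    where
    hd : ∀ {w} → w ∈ map (y ∷_) (insertions x ys) → x ∷ y ∷ ys ≢ w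
    hd w∈ eq with ∈-map⁻ (y ∷_) w∈
    ... | w' , _ , refl = nx (here (cong (λ { [] → x ; (h ∷ _) → h }) eq))

  perms-unique : ∀ xs → Unique xs → Unique (perms xs)
  perms-unique [] u = [] ∷ []
  perms-unique (x ∷ xs) (px ∷ u) =
    UP.concat⁺ (AllP.map⁺ (All.tabulate (λ v∈ → insertions-unique x _ (nx v∈))))
               (APP.map⁺ (pairs (perms xs) (perms-unique xs u) (All.tabulate nx)))
    where
    nx : ∀ {v} → v ∈ perms xs → x ∉ v
    nx v∈ x∈ = All.lookup px (∈-resp-↭ (perms-↭ xs v∈) x∈) refl
    pairs : ∀ vs → Unique vs → All (x ∉_) vs → AllPairs (λ a b → Disjoint (insertions x a) (insertions x b)) vs
    pairs [] _ _ = []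
    pairs (v ∷ vs) (pv ∷ uv) (nv ∷ nvs) =
      All.tabulate (λ {b} b∈ (w∈a , w∈b) → All.lookup pv b∈
         (trans (sym (delete-insertions x v w∈a nv)) (delete-insertions x b w∈b (All.lookup nvs b∈))))
      ∷ pairs vs uv nvs

  unique-resp-↭ : ∀ {xs ys : List ℕ} → xs ↭ ys → Unique xs → Unique ys
  unique-resp-↭ p u = PSP.Unique-resp-↭ (setoid ℕ) (↭⇒↭ₛ p) u

  <ᵇ-true : ∀ {a b} → a < b → (a <ᵇ b) ≡ true
  <ᵇ-true {a} {b} a<b = Equivalence.to T-≡ (NP.<⇒<ᵇ a<b)

  <ᵇ-false : ∀ {a b} → ¬ a < b → (a <ᵇ b) ≡ false
  <ᵇ-false {a} {b} nlt with a <ᵇ b in eq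
  ... | false = refl
  ... | true = ⊥-elim (nlt (NP.<ᵇ⇒< a b (subst T (sym eq) tt)))

  ind : Bool → ℕ
  ind b = if b then 1 else 0

  less : ℕ → ℕ → ℕ
  less a b = ind (a <ᵇ b)

  below : List ℕ → ℕ → ℕ
  below v b = ΣL v (λ c → less c b)

  above : List ℕ → ℕ → ℕ
  above v a = ΣL v (λ c → less a c)

  less-monoʳ : ∀ c {a b} → a ≤ b → less c a ≤ less c b
  less-monoʳ c {a} {b} le with c N.<? a
  ... | yes ca = NP.≤-reflexive (trans (cong ind (<ᵇ-true ca)) (sym (cong ind (<ᵇ-true (NP.<-≤-trans ca le)))))
  ... | no nca = subst (_≤ less c b) (sym (cong ind (<ᵇ-false nca))) z≤n

  less-monoˡ : ∀ c {a b} → a ≤ b → less b c ≤ less a c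
  less-monoˡ c {a} {b} le with b N.<? c
  ... | yes bc = NP.≤-reflexive (trans (cong ind (<ᵇ-true bc)) (sym (cong ind (<ᵇ-true (NP.≤-<-trans le bc)))))
  ... | no nbc = subst (_≤ less a c) (sym (cong ind (<ᵇ-false nbc))) z≤n

  ΣL-mono : ∀ (v : List ℕ) {f g : ℕ → ℕ} → (∀ c → f c ≤ g c) → ΣL v f ≤ ΣL v g
  ΣL-mono [] le = z≤n
  ΣL-mono (c ∷ v) le = NP.+-mono-≤ (le c) (ΣL-mono v le)

  below-mono : ∀ v {a b} → a ≤ b → below v a ≤ below v b
  below-mono v le = ΣL-mono v (λ c → less-monoʳ c le)

  above-anti : ∀ v {a b} → a ≤ b → above v b ≤ above v a
  above-anti v le = ΣL-mono v (λ c → less-monoˡ c le)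

  less-irrefl : ∀ a → less a a ≡ 0
  less-irrefl a = cong ind (<ᵇ-false (NP.n≮n a))

  below-strict : ∀ v {a b} → a < b → a ∈ v → suc (below v a) ≤ below v b
  below-strict (c ∷ v) {a} {b} ab (here refl) =
    subst (λ z → suc z ≤ less a b + below v b) (sym (cong (_+ below v a) (less-irrefl a)))
    (subst (λ z → suc (below v a) ≤ z + below v b) (sym (cong ind (<ᵇ-true ab))) (s≤s (below-mono v (NP.<⇒≤ ab))))
  below-strict (c ∷ v) {a} {b} ab (there p) =
    subst (_≤ less c b + below v b) (NP.+-suc (less c a) (below v a))
      (NP.+-mono-≤ (less-monoʳ c (NP.<⇒≤ ab)) (below-strict v ab p))

  above-strict : ∀ v {a b} → a < b → b ∈ v → suc (above v b) ≤ above v a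
  above-strict (c ∷ v) {a} {b} ab (here refl) =
    subst (λ z → suc z ≤ less a b + above v a) (sym (cong (_+ above v b) (less-irrefl b)))
    (subst (λ z → suc (above v b) ≤ z + above v a) (sym (cong ind (<ᵇ-true ab))) (s≤s (above-anti v (NP.<⇒≤ ab))))
  above-strict (c ∷ v) {a} {b} ab (there p) =
    subst (_≤ less a c + above v a) (NP.+-suc (less b c) (above v b))
      (NP.+-mono-≤ (less-monoˡ c (NP.<⇒≤ ab)) (above-strict v ab p))

  less-total : ∀ a c → a ≢ c → less c a + less a c ≡ 1
  less-total a c ne with N.<-cmp a c
  ... | tri< ac _ _ = trans (cong₂ _+_ (cong ind (<ᵇ-false (NP.<⇒≯ ac))) (cong ind (<ᵇ-true ac))) refl
  ... | tri≈ _ e _ = ⊥-elim (ne e)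
  ... | tri> _ _ ca = trans (cong₂ _+_ (cong ind (<ᵇ-true ca)) (cong ind (<ᵇ-false (NP.<⇒≯ ca)))) refl

  below+above∉ : ∀ v a → a ∉ v → below v a + above v a ≡ length v
  below+above∉ [] a na = refl
  below+above∉ (c ∷ v) a na = trans (+-interchange (less c a) (below v a) (less a c) (above v a))
    (cong₂ _+_ (less-total a c (λ e → na (here e))) (below+above∉ v a (na ∘ there)))

  below+above∈ : ∀ v a → Unique v → a ∈ v → suc (below v a + above v a) ≡ length v
  below+above∈ (c ∷ v) a (pc ∷ u) (here refl) = begin
    suc ((less a a + below v a) + (less a a + above v a)) ≡⟨ cong (λ z → suc ((z + below v a) + (z + above v a))) (less-irrefl a) ⟩
    suc (below v a + above v a) ≡⟨ cong suc (below+above∉ v a (λ a∈ → All.lookup pc a∈ refl)) ⟩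
    suc (length v) ∎
    where open ≡-Reasoning
  below+above∈ (c ∷ v) a (pc ∷ u) (there p) = begin
    suc ((less c a + below v a) + (less a c + above v a)) ≡⟨ cong suc (+-interchange (less c a) (below v a) (less a c) (above v a)) ⟩
    suc ((less c a + less a c) + (below v a + above v a)) ≡⟨ cong (λ z → suc (z + (below v a + above v a))) (less-total a c (λ { refl → All.lookup pc p refl })) ⟩
    suc (suc (below v a + above v a)) ≡⟨ cong suc (below+above∈ v a u p) ⟩
    suc (length v) ∎
    where open ≡-Reasoning

  rank-inj : ∀ v {a b} → a ∈ v → b ∈ v → below v a ≡ below v b → a ≡ b
  rank-inj v {a} {b} a∈ b∈ e with N.<-cmp a b
  ... | tri< ab _ _ = ⊥-elim (NP.<-irrefl e (below-strict v ab a∈))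
  ... | tri≈ _ ab _ = ab
  ... | tri> _ _ ba = ⊥-elim (NP.<-irrefl (sym e) (below-strict v ba b∈))

  ind≤1 : ∀ b → ind b ≤ 1
  ind≤1 true = s≤s z≤n
  ind≤1 false = z≤n

  below≤len : ∀ v b → below v b ≤ length v
  below≤len [] b = z≤n
  below≤len (c ∷ v) b = NP.+-mono-≤ (ind≤1 (c <ᵇ b)) (below≤len v b)

  less-0 : ∀ {a b} → ¬ a < b → less a b ≡ 0
  less-0 nab = cong ind (<ᵇ-false nab)

  less-1 : ∀ {a b} → a < b → less a b ≡ 1
  less-1 ab = cong ind (<ᵇ-true ab)

  rank-exist : ∀ v → Unique v → ∀ r → r < length v → ∃ λ b → b ∈ v × below v b ≡ r
  rank-exist (x ∷ v) (px ∷ u) r r< with N.<-cmp r (below v x)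
  ... | tri≈ _ e _ = x , here refl , trans (cong (_+ below v x) (less-irrefl x)) (sym e)
  ... | tri< rρ _ _ with rank-exist v u r (NP.<-≤-trans rρ (below≤len v x))
  ...   | b , b∈ , eb = b , there b∈ , trans (cong (_+ below v b) (less-0 nxb)) eb
    where
    nxb : ¬ x < b
    nxb xb = NP.<-irrefl refl (NP.<-≤-trans rρ (subst (below v x ≤_) eb (below-mono v (NP.<⇒≤ xb))))
  rank-exist (x ∷ v) (px ∷ u) (suc r') r< | tri> _ _ ρr with rank-exist v u r' (NP.≤-pred r<)
  ...   | b , b∈ , eb = b , there b∈ , trans (cong (_+ below v b) (less-1 xb)) (cong suc eb)
    where
    xb : x < b
    xb with N.<-cmp x b
    ... | tri< xb' _ _ = xb'
    ... | tri≈ _ e _ = ⊥-elim (All.lookup px b∈ e)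
    ... | tri> _ _ bx = ⊥-elim (NP.<-irrefl refl (NP.<-≤-trans ρr (subst (λ z → suc z ≤ below v x) eb (below-strict v bx b∈))))
  rank-exist (x ∷ v) (px ∷ u) zero r< | tri> _ _ ()

  -- The first element of a list satisfying a test (0 if there is none).
  find : (ℕ → Bool) → List ℕ → ℕ
  find p [] = 0
  find p (x ∷ xs) = if p x then x else find p xs

  find-spec : ∀ p xs {b} → b ∈ xs → p b ≡ true → find p xs ∈ xs × p (find p xs) ≡ true
  find-spec p (x ∷ xs) {b} b∈ pb with p x in eq
  ... | true = here refl , eq
  find-spec p (x ∷ xs) {b} (here refl) pb | false = ⊥-elim (subst T (trans (sym pb) eq) tt)
  find-spec p (x ∷ xs) {b} (there b∈) pb | false with find-spec p xs b∈ pb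
  ... | f∈ , pf = there f∈ , pf

  -- mirror v a is the element of v whose rank equals the co-rank of a, i.e. the image of a
  -- under the order-reversing bijection of the values of v.
  mirror : List ℕ → ℕ → ℕ
  mirror v a = find (λ b → below v b ≡ᵇ above v a) v

  above<len : ∀ v a → Unique v → a ∈ v → above v a < length v
  above<len v a u a∈ = subst (above v a <_) (below+above∈ v a u a∈) (s≤s (NP.m≤n+m (above v a) (below v a)))

  mirror-spec : ∀ v a → Unique v → a ∈ v → mirror v a ∈ v × below v (mirror v a) ≡ above v a
  mirror-spec v a u a∈ with rank-exist v u (above v a) (above<len v a u a∈)
  ... | b , b∈ , eb with find-spec (λ b → below v b ≡ᵇ above v a) v b∈ (Equivalence.to T-≡ (NP.≡⇒≡ᵇ _ _ eb))
  ... | f∈ , pf = f∈ , NP.≡ᵇ⇒≡ _ _ (subst T (sym pf) tt)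

  mirror-invol : ∀ v a → Unique v → a ∈ v → mirror v (mirror v a) ≡ a
  mirror-invol v a u a∈ = rank-inj v s2∈ a∈ (trans e2 abS)
    where
    s = mirror v a
    s∈ = proj₁ (mirror-spec v a u a∈)
    es = proj₂ (mirror-spec v a u a∈)
    s2∈ = proj₁ (mirror-spec v s u s∈)
    e2 = proj₂ (mirror-spec v s u s∈)
    abS : above v s ≡ below v a
    abS = NP.+-cancelˡ-≡ (above v a) (above v s) (below v a)
      (trans (cong (_+ above v s) (sym es))
      (trans (NP.suc-injective (trans (below+above∈ v s u s∈) (sym (below+above∈ v a u a∈)))) (NP.+-comm (below v a) (above v a))))

  mirror-anti : ∀ v {a b} → Unique v → a ∈ v → b ∈ v → a < b → mirror v b < mirror v a
  mirror-anti v {a} {b} u a∈ b∈ ab with N.<-cmp (mirror v b) (mirror v a)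
  ... | tri< lt' _ _ = lt'
  ... | tri≈ _ e _ = ⊥-elim (NP.<-irrefl (trans (sym (proj₂ (mirror-spec v b u b∈))) (trans (cong (below v) e) (proj₂ (mirror-spec v a u a∈)))) (above-strict v ab b∈))
  ... | tri> _ _ gt = ⊥-elim (NP.<-irrefl refl (NP.<-≤-trans (above-strict v ab b∈)
          (subst₂ _≤_ (proj₂ (mirror-spec v a u a∈)) (proj₂ (mirror-spec v b u b∈)) (below-mono v (NP.<⇒≤ gt)))))

  mirror-↭ : ∀ v v' a → Unique v → v ↭ v' → a ∈ v → mirror v' a ≡ mirror v a
  mirror-↭ v v' a u p a∈ = rank-inj v s'∈ s∈ (trans (sym (bl (mirror v' a))) (trans e' (trans (ab a) (sym e))))
    where
    u' = unique-resp-↭ p u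
    bl : ∀ b → below v' b ≡ below v b
    bl b = sym (ΣL-↭ (λ c → less c b) p)
    ab : ∀ b → above v' b ≡ above v b
    ab b = sym (ΣL-↭ (λ c → less b c) p)
    s'∈ = ∈-resp-↭ (↭-sym p) (proj₁ (mirror-spec v' a u' (∈-resp-↭ p a∈)))
    e' = proj₂ (mirror-spec v' a u' (∈-resp-↭ p a∈))
    s∈ = proj₁ (mirror-spec v a u a∈)
    e = proj₂ (mirror-spec v a u a∈)

  -- reflect v reverses the relative order of the values of v, keeping their positions:
  -- it is a rearrangement of v, an involution, and turns ascents into descents.
  reflect : List ℕ → List ℕ
  reflect v = map (mirror v) v

  reflect-↭ : ∀ v → Unique v → reflect v ↭ v
  reflect-↭ v u = involution-↭ (mirror v) u (λ a∈ → proj₁ (mirror-spec v _ u a∈)) (λ a∈ → mirror-invol v _ u a∈)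

  reflect-invol : ∀ v → Unique v → reflect (reflect v) ≡ v
  reflect-invol v u = trans (sym (LP.map-∘ v)) (LP.map-id-local (All.tabulate (λ {a} a∈ →
    trans (mirror-↭ v (reflect v) (mirror v a) u (↭-sym (reflect-↭ v u)) (proj₁ (mirror-spec v a u a∈))) (mirror-invol v a u a∈))))

  -- Alternating descents.  The parity of a position decides whether an ascent or a descent
  -- counts, so shifting all positions by one exchanges the two conventions.
  even?-suc : ∀ i → even? (suc i) ≡ not (even? i)
  even?-suc zero = refl
  even?-suc (suc zero) = refl
  even?-suc (suc (suc i)) = even?-suc i

  -- Reversing the comparison of a pair is the same as moving it to a position of other parity.
  altDesAt-anti : ∀ i {x y a b} → (x <ᵇ y) ≡ (b <ᵇ a) → (y <ᵇ x) ≡ (a <ᵇ b) → altDesAt i x y ≡ altDesAt (suc i) a b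
  altDesAt-anti i {x} {y} {a} {b} e1 e2 = lem (even? i) (even?-suc i)
    where
    lem : ∀ ev → even? (suc i) ≡ not ev → (if ev then ind (x <ᵇ y) else ind (y <ᵇ x)) ≡ altDesAt (suc i) a b
    lem true e rewrite e | e1 = refl
    lem false e rewrite e | e2 = refl

  altDesAt-flip : ∀ i {a b} → a ≢ b → altDesAt i a b + altDesAt (suc i) a b ≡ 1
  altDesAt-flip i {a} {b} ne with even? i | even?-suc i | N.<-cmp a b
  ... | true | e | tri< ab _ _ rewrite e | <ᵇ-true ab | <ᵇ-false (NP.<⇒≯ ab) = refl
  ... | true | e | tri≈ _ ab _ = ⊥-elim (ne ab)
  ... | true | e | tri> _ _ ba rewrite e | <ᵇ-true ba | <ᵇ-false (NP.<⇒≯ ba) = refl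
  ... | false | e | tri< ab _ _ rewrite e | <ᵇ-true ab | <ᵇ-false (NP.<⇒≯ ab) = refl
  ... | false | e | tri≈ _ ab _ = ⊥-elim (ne ab)
  ... | false | e | tri> _ _ ba rewrite e | <ᵇ-true ba | <ᵇ-false (NP.<⇒≯ ba) = refl

  altdes-suc : ∀ i v → altdesFrom i (map suc v) ≡ altdesFrom i v
  altdes-suc i [] = refl
  altdes-suc i (a ∷ []) = refl
  altdes-suc i (a ∷ b ∷ v) = cong (altDesAt i a b +_) (altdes-suc (suc i) (b ∷ v))

  altdes-two : ∀ i v → altdesFrom (suc (suc i)) v ≡ altdesFrom i v
  altdes-two i [] = refl
  altdes-two i (a ∷ []) = refl
  altdes-two i (a ∷ b ∷ v) = cong (altDesAt i a b +_) (altdes-two (suc i) (b ∷ v))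

  anti-pair : ∀ {f : ℕ → ℕ} {a b} → a ≢ b → (a < b → f b < f a) → (b < a → f a < f b) →
    ((f a <ᵇ f b) ≡ (b <ᵇ a)) × ((f b <ᵇ f a) ≡ (a <ᵇ b))
  anti-pair {f} {a} {b} ne h1 h2 with N.<-cmp a b
  ... | tri< ab _ _ = trans (<ᵇ-false (NP.<⇒≯ (h1 ab))) (sym (<ᵇ-false (NP.<⇒≯ ab))) , trans (<ᵇ-true (h1 ab)) (sym (<ᵇ-true ab))
  ... | tri≈ _ e _ = ⊥-elim (ne e)
  ... | tri> _ _ ba = trans (<ᵇ-true (h2 ba)) (sym (<ᵇ-true ba)) , trans (<ᵇ-false (NP.<⇒≯ (h2 ba))) (sym (<ᵇ-false (NP.<⇒≯ ba)))

  -- Applying an order-reversing map to the values shifts the parity convention: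
  -- for instance altdes of the complement of π is altdesFrom 2 π.
  altdes-anti : ∀ i v (f : ℕ → ℕ) → Unique v → (∀ {a b} → a ∈ v → b ∈ v → a < b → f b < f a) →
    altdesFrom i (map f v) ≡ altdesFrom (suc i) v
  altdes-anti i [] f u h = refl
  altdes-anti i (a ∷ []) f u h = refl
  altdes-anti i (a ∷ b ∷ v) f (pa ∷ u) h =
    cong₂ _+_ (altDesAt-anti i {f a} {f b} {a} {b} (proj₁ ap) (proj₂ ap))
              (altdes-anti (suc i) (b ∷ v) f u (λ x y → h (there x) (there y)))
    where
    ne : a ≢ b
    ne = All.lookup pa (here refl)
    ap = anti-pair {f} ne (h (here refl) (there (here refl))) (h (there (here refl)) (here refl))

  -- Every adjacent pair counts for exactly one of the two conventions, so
  -- altdes π + altdes (complement π) = m - 1 on 𝔖_m.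
  altdes-flip : ∀ i v → Unique v → altdesFrom i v + altdesFrom (suc i) v ≡ length v ∸ 1
  altdes-flip i [] u = refl
  altdes-flip i (a ∷ []) u = refl
  altdes-flip i (a ∷ b ∷ v) (pa ∷ u) = begin
    (altDesAt i a b + altdesFrom (suc i) (b ∷ v)) + (altDesAt (suc i) a b + altdesFrom (suc (suc i)) (b ∷ v))
      ≡⟨ +-interchange (altDesAt i a b) _ (altDesAt (suc i) a b) _ ⟩
    (altDesAt i a b + altDesAt (suc i) a b) + (altdesFrom (suc i) (b ∷ v) + altdesFrom (suc (suc i)) (b ∷ v))
      ≡⟨ cong₂ _+_ (altDesAt-flip i (All.lookup pa (here refl))) (altdes-flip (suc i) (b ∷ v) u) ⟩
    suc (length v) ∎
    where open ≡-Reasoning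

  headDes : ℕ → ℕ → List ℕ → ℕ
  headDes i p [] = 0
  headDes i p (x ∷ _) = altDesAt i p x

  altdes-cons : ∀ i p X → altdesFrom i (p ∷ X) ≡ headDes i p X + altdesFrom (suc i) X
  altdes-cons i p [] = refl
  altdes-cons i p (x ∷ X) = refl

  headDes-++ : ∀ i p P a Y → headDes i p (P ++ a ∷ Y) ≡ headDes i p (P ++ a ∷ [])
  headDes-++ i p [] a Y = refl
  headDes-++ i p (x ∷ P) a Y = refl

  altdes-split : ∀ i P a c Q → altdesFrom i (P ++ a ∷ c ∷ Q) ≡
    altdesFrom i (P ++ a ∷ []) + altDesAt (i + length P) a c + altdesFrom (suc (i + length P)) (c ∷ Q)
  altdes-split i [] a c Q = cong₂ (λ x y → altDesAt x a c + altdesFrom (suc y) (c ∷ Q)) (sym (NP.+-identityʳ i)) (sym (NP.+-identityʳ i))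
  altdes-split i (p ∷ P) a c Q = begin
    altdesFrom i (p ∷ (P ++ a ∷ c ∷ Q)) ≡⟨ altdes-cons i p (P ++ a ∷ c ∷ Q) ⟩
    headDes i p (P ++ a ∷ c ∷ Q) + altdesFrom (suc i) (P ++ a ∷ c ∷ Q) ≡⟨ cong₂ _+_ (headDes-++ i p P a (c ∷ Q)) (altdes-split (suc i) P a c Q) ⟩
    headDes i p (P ++ a ∷ []) + (altdesFrom (suc i) (P ++ a ∷ []) + altDesAt (suc i + length P) a c + altdesFrom (suc (suc i + length P)) (c ∷ Q))
      ≡⟨ cong (λ z → headDes i p (P ++ a ∷ []) + (altdesFrom (suc i) (P ++ a ∷ []) + altDesAt z a c + altdesFrom (suc z) (c ∷ Q))) (sym (NP.+-suc i (length P))) ⟩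
    headDes i p (P ++ a ∷ []) + (altdesFrom (suc i) (P ++ a ∷ []) + altDesAt (i + suc (length P)) a c + altdesFrom (suc (i + suc (length P))) (c ∷ Q))
      ≡⟨ assoc3 (headDes i p (P ++ a ∷ [])) (altdesFrom (suc i) (P ++ a ∷ [])) _ _ ⟩
    (headDes i p (P ++ a ∷ []) + altdesFrom (suc i) (P ++ a ∷ [])) + altDesAt (i + suc (length P)) a c + altdesFrom (suc (i + suc (length P))) (c ∷ Q)
      ≡⟨ cong (λ z → z + altDesAt (i + suc (length P)) a c + altdesFrom (suc (i + suc (length P))) (c ∷ Q)) (sym (altdes-cons i p (P ++ a ∷ []))) ⟩
    altdesFrom i (p ∷ P ++ a ∷ []) + altDesAt (i + suc (length P)) a c + altdesFrom (suc (i + suc (length P))) (c ∷ Q) ∎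
    where
    open ≡-Reasoning
    assoc3 : ∀ a b c d → a + (b + c + d) ≡ (a + b) + c + d
    assoc3 a b c d = trans (sym (NP.+-assoc a (b + c) d)) (cong (_+ d) (sym (NP.+-assoc a b c)))

  -- Every π ∈ 𝔖_{m+1} is obtained from a w ∈ 𝔖_m by raising
  -- all values by one and inserting 1 at some position j.  Before inserting we "twist" w:
  -- twist j w reverses the relative order of the values after position j.  This makes the
  -- alternating descents of the result computable from those of w (altdesIns-first/middle/last).
  insertAt : ℕ → ℕ → List ℕ → List ℕ
  insertAt j y xs = take j xs ++ y ∷ drop j xs

  twist : ℕ → List ℕ → List ℕ
  twist j x = take j x ++ reflect (drop j x)

  altdesIns : ℕ → List ℕ → ℕ
  altdesIns j x = altdes (insertAt j 1 (map suc x))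

  take-length-++ : ∀ (A B : List ℕ) → take (length A) (A ++ B) ≡ A
  take-length-++ []      B = refl
  take-length-++ (a ∷ A) B = cong (a ∷_) (take-length-++ A B)

  drop-length-++ : ∀ (A B : List ℕ) → drop (length A) (A ++ B) ≡ B
  drop-length-++ []      B = refl
  drop-length-++ (a ∷ A) B = drop-length-++ A B

  insertAt-++ : ∀ A y B → insertAt (length A) y (A ++ B) ≡ A ++ y ∷ B
  insertAt-++ A y B = cong₂ (λ p q → p ++ y ∷ q) (take-length-++ A B) (drop-length-++ A B)

  twist-++ : ∀ A B → twist (length A) (A ++ B) ≡ A ++ reflect B
  twist-++ A B = cong₂ (λ p q → p ++ reflect q) (take-length-++ A B) (drop-length-++ A B)

  unique-suffix : ∀ (u : List ℕ) {w} → Unique (u ++ w) → Unique w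
  unique-suffix []      p       = p
  unique-suffix (_ ∷ u) (_ ∷ p) = unique-suffix u p

  length-snoc : ∀ (u : List ℕ) a → length (u ++ a ∷ []) ≡ suc (length u)
  length-snoc u a = trans (LP.length-++ u) (NP.+-comm (length u) 1)

  twisted-insertion : ∀ u a V →
    insertAt (suc (length u)) 1 (map suc (twist (suc (length u)) (u ++ a ∷ V)))
      ≡ map suc u ++ suc a ∷ 1 ∷ map suc (reflect V)
  twisted-insertion u a V = begin
    insertAt (suc (length u)) 1 (map suc (twist (suc (length u)) (u ++ a ∷ V)))
      ≡⟨ cong₂ (λ j w → insertAt j 1 (map suc (twist j w))) (sym (length-snoc u a)) (sym (LP.++-assoc u (a ∷ []) V)) ⟩
    insertAt (length ua) 1 (map suc (twist (length ua) (ua ++ V)))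
      ≡⟨ cong (λ w → insertAt (length ua) 1 (map suc w)) (twist-++ ua V) ⟩
    insertAt (length ua) 1 (map suc (ua ++ reflect V))
      ≡⟨ cong₂ (λ j w → insertAt j 1 w) (sym (LP.length-map suc ua)) (LP.map-++ suc ua (reflect V)) ⟩
    insertAt (length (map suc ua)) 1 (map suc ua ++ map suc (reflect V))
      ≡⟨ insertAt-++ (map suc ua) 1 (map suc (reflect V)) ⟩
    map suc ua ++ 1 ∷ map suc (reflect V)
      ≡⟨ cong (_++ 1 ∷ map suc (reflect V)) (LP.map-++ suc u (a ∷ [])) ⟩
    (map suc u ++ suc a ∷ []) ++ 1 ∷ map suc (reflect V)
      ≡⟨ LP.++-assoc (map suc u) (suc a ∷ []) _ ⟩
    map suc u ++ suc a ∷ 1 ∷ map suc (reflect V) ∎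
    where
    open ≡-Reasoning
    ua = u ++ a ∷ []

  -- Comparisons with the inserted value 1 are decided by the parity of the position alone.
  parity : ℕ → ℕ
  parity j = if even? j then 0 else 1

  parity≤1 : ∀ j → parity j ≤ 1
  parity≤1 j with even? j
  ... | true  = z≤n
  ... | false = s≤s z≤n

  before-one : ∀ j a → 1 ≤ a → altDesAt j (suc a) 1 ≡ parity j
  before-one j (suc a) _ with even? j
  ... | true  = refl
  ... | false = refl

  after-one : ∀ t c → 1 ≤ c → altDesAt (suc (suc t)) 1 (suc c) ≡ parity (suc t)
  after-one t (suc c) _ rewrite even?-suc t with even? t
  ... | true  = refl
  ... | false = refl

  altdes-before-one : ∀ u a → 1 ≤ a →
    altdesFrom 1 (map suc u ++ suc a ∷ []) + altDesAt (1 + length (map suc u)) (suc a) 1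
      ≡ altdesFrom 1 (u ++ a ∷ []) + parity (suc (length u))
  altdes-before-one u a a≥1 = cong₂ _+_
    (trans (cong (altdesFrom 1) (sym (LP.map-++ suc u (a ∷ [])))) (altdes-suc 1 (u ++ a ∷ [])))
    (trans (cong (λ z → altDesAt (suc z) (suc a) 1) (LP.length-map suc u)) (before-one (suc (length u)) a a≥1))

  altdes-after-one : ∀ t b v → Unique (b ∷ v) → (∀ {c} → c ∈ b ∷ v → 1 ≤ c) →
    altdesFrom (suc (suc t)) (1 ∷ map suc (reflect (b ∷ v))) ≡ parity (suc t) + altdesFrom (suc (suc t)) (b ∷ v)
  altdes-after-one t b v u pos = cong₂ _+_
    (after-one t (mirror V b) (pos (proj₁ (mirror-spec V b u (here refl)))))
    (trans (altdes-suc _ (reflect V))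
    (trans (altdes-anti _ V (mirror V) u (λ a∈ b∈ ab → mirror-anti V u a∈ b∈ ab)) (altdes-two (suc (suc t)) V)))
    where V = b ∷ v

  altdesIns-first : ∀ x → Unique x → altdesIns 0 (twist 0 x) ≡ altdes x
  altdesIns-first x u = begin
    altdesFrom 1 (1 ∷ map suc (reflect x))                                 ≡⟨ altdes-cons 1 1 (map suc (reflect x)) ⟩
    headDes 1 1 (map suc (reflect x)) + altdesFrom 2 (map suc (reflect x))   ≡⟨ cong₂ _+_ (no-descent (reflect x)) (altdes-suc 2 (reflect x)) ⟩
    altdesFrom 2 (reflect x)                                               ≡⟨ altdes-anti 2 x (mirror x) u (λ a∈ b∈ ab → mirror-anti x u a∈ b∈ ab) ⟩
    altdesFrom 3 x                                                         ≡⟨ altdes-two 1 x ⟩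
    altdes x                                                               ∎
    where
    open ≡-Reasoning
    no-descent : ∀ z → headDes 1 1 (map suc z) ≡ 0
    no-descent []      = refl
    no-descent (c ∷ z) = refl

  -- Inner position j = |u| + 1, between a and b: the pair (a, b) is replaced by
  -- (a, 1, b'), which contributes parity j twice, and the tail changes convention.
  altdesIns-middle' : ∀ u a b v → Unique (u ++ a ∷ b ∷ v) → (∀ {c} → c ∈ u ++ a ∷ b ∷ v → 1 ≤ c) →
    altdesIns (suc (length u)) (twist (suc (length u)) (u ++ a ∷ b ∷ v)) + altDesAt (suc (length u)) a b
      ≡ altdes (u ++ a ∷ b ∷ v) + 2 * parity (suc (length u))
  altdesIns-middle' u a b v uniq pos = begin
    altdesFrom 1 (insertAt (suc ℓ) 1 (map suc (twist (suc ℓ) (u ++ a ∷ V)))) + pairDes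
      ≡⟨ cong (λ z → altdesFrom 1 z + pairDes) (twisted-insertion u a V) ⟩
    altdesFrom 1 (map suc u ++ suc a ∷ 1 ∷ map suc (reflect V)) + pairDes
      ≡⟨ cong (_+ pairDes) (altdes-split 1 (map suc u) (suc a) 1 (map suc (reflect V))) ⟩
    (altdesFrom 1 (map suc u ++ suc a ∷ []) + altDesAt (1 + length (map suc u)) (suc a) 1
       + altdesFrom (suc (1 + length (map suc u))) (1 ∷ map suc (reflect V))) + pairDes
      ≡⟨ cong₂ (λ p q → p + q + pairDes) (altdes-before-one u a (pos (∈-++⁺ʳ u (here refl))))
               (trans (cong (λ z → altdesFrom (suc (suc z)) (1 ∷ map suc (reflect V))) (LP.length-map suc u))
                      (altdes-after-one ℓ b v uniqV (λ c∈ → pos (∈-++⁺ʳ u (there c∈))))) ⟩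
    (altdesFrom 1 (u ++ a ∷ []) + parity (suc ℓ) + (parity (suc ℓ) + altdesFrom (suc (suc ℓ)) V)) + pairDes
      ≡⟨ regroup (altdesFrom 1 (u ++ a ∷ [])) (parity (suc ℓ)) (altdesFrom (suc (suc ℓ)) V) pairDes ⟩
    (altdesFrom 1 (u ++ a ∷ []) + pairDes + altdesFrom (suc (suc ℓ)) V) + 2 * parity (suc ℓ)
      ≡⟨ cong (_+ 2 * parity (suc ℓ)) (sym (altdes-split 1 u a b v)) ⟩
    altdes (u ++ a ∷ b ∷ v) + 2 * parity (suc ℓ) ∎
    where
    open ≡-Reasoning
    ℓ = length u
    V = b ∷ v
    pairDes = altDesAt (suc ℓ) a b
    uniqV : Unique V
    uniqV = unique-suffix (u ++ a ∷ []) (subst Unique (sym (LP.++-assoc u (a ∷ []) V)) uniq)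
    regroup : ∀ D o S E → (D + o + (o + S)) + E ≡ (D + E + S) + 2 * o
    regroup = solve-∀

  -- Last position j = m: 1 is appended and the final pair contributes parity m.
  altdesIns-last' : ∀ u a → 1 ≤ a →
    altdesIns (length (u ++ a ∷ [])) (twist (length (u ++ a ∷ [])) (u ++ a ∷ []))
      ≡ altdes (u ++ a ∷ []) + parity (length (u ++ a ∷ []))
  altdesIns-last' u a a≥1 = begin
    altdesFrom 1 (insertAt m 1 (map suc (twist m X)))
      ≡⟨ cong (λ z → altdesFrom 1 (insertAt m 1 (map suc z))) (twist-all X) ⟩
    altdesFrom 1 (insertAt m 1 (map suc X))
      ≡⟨ cong₂ (λ j w → altdesFrom 1 (insertAt j 1 w)) (sym (LP.length-map suc X)) (sym (LP.++-identityʳ (map suc X))) ⟩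
    altdesFrom 1 (insertAt (length (map suc X)) 1 (map suc X ++ []))
      ≡⟨ cong (altdesFrom 1) (insertAt-++ (map suc X) 1 []) ⟩
    altdesFrom 1 (map suc X ++ 1 ∷ [])
      ≡⟨ cong (λ z → altdesFrom 1 (z ++ 1 ∷ [])) (LP.map-++ suc u (a ∷ [])) ⟩
    altdesFrom 1 ((map suc u ++ suc a ∷ []) ++ 1 ∷ [])
      ≡⟨ cong (altdesFrom 1) (LP.++-assoc (map suc u) (suc a ∷ []) (1 ∷ [])) ⟩
    altdesFrom 1 (map suc u ++ suc a ∷ 1 ∷ [])
      ≡⟨ altdes-split 1 (map suc u) (suc a) 1 [] ⟩
    altdesFrom 1 (map suc u ++ suc a ∷ []) + altDesAt (1 + length (map suc u)) (suc a) 1 + 0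
      ≡⟨ NP.+-identityʳ _ ⟩
    altdesFrom 1 (map suc u ++ suc a ∷ []) + altDesAt (1 + length (map suc u)) (suc a) 1
      ≡⟨ altdes-before-one u a a≥1 ⟩
    altdes X + parity (suc (length u))
      ≡⟨ cong (λ z → altdes X + parity z) (sym (length-snoc u a)) ⟩
    altdes X + parity m ∎
    where
    open ≡-Reasoning
    X = u ++ a ∷ []
    m = length X
    twist-all : ∀ x → twist (length x) x ≡ x
    twist-all x = trans (cong (twist (length x)) (sym (LP.++-identityʳ x))) (trans (twist-++ x []) (LP.++-identityʳ x))

  snoc-view : ∀ a x → ∃₂ λ (u : List ℕ) (b : ℕ) → a ∷ x ≡ u ++ b ∷ []
  snoc-view a []      = [] , a , refl
  snoc-view a (c ∷ x) with snoc-view c x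
  ... | u , b , e = a ∷ u , b , cong (a ∷_) e

  altdesIns-last : ∀ a x → (∀ {c} → c ∈ a ∷ x → 1 ≤ c) →
    altdesIns (length (a ∷ x)) (twist (length (a ∷ x)) (a ∷ x)) ≡ altdes (a ∷ x) + parity (length (a ∷ x))
  altdesIns-last a x pos with snoc-view a x
  ... | u , b , e = subst (λ X → altdesIns (length X) (twist (length X) X) ≡ altdes X + parity (length X)) (sym e)
                          (altdesIns-last' u b (pos (subst (b ∈_) (sym e) (∈-++⁺ʳ u (here refl)))))

  -- The alternating-descent indicator of w at position j (between w_j and w_{j+1}, 1-based).
  nth : List ℕ → ℕ → ℕ
  nth []      _       = 0
  nth (a ∷ _) zero    = a
  nth (_ ∷ x) (suc t) = nth x t

  desAt : ℕ → List ℕ → ℕ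
  desAt j x = altDesAt j (nth x (j ∸ 1)) (nth x j)

  desAt≤1 : ∀ j x → desAt j x ≤ 1
  desAt≤1 j x with even? j
  ... | true  = ind≤1 _
  ... | false = ind≤1 _

  Σ-desAt-from : ∀ i x → Σ< (length x ∸ 1) (λ t → altDesAt (i + t) (nth x t) (nth x (suc t))) ≡ altdesFrom i x
  Σ-desAt-from i []          = refl
  Σ-desAt-from i (a ∷ [])    = refl
  Σ-desAt-from i (a ∷ b ∷ y) = cong₂ _+_ (cong (λ z → altDesAt z a b) (NP.+-identityʳ i))
    (trans (Σ<-cong (length y) (λ t → cong (λ z → altDesAt z (nth (b ∷ y) t) (nth (b ∷ y) (suc t))) (NP.+-suc i t)))
           (Σ-desAt-from (suc i) (b ∷ y)))

  Σ-desAt : ∀ x → Σ< (length x ∸ 1) (λ t → desAt (suc t) x) ≡ altdes x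
  Σ-desAt x = Σ-desAt-from 1 x

  split-at : ∀ t x → suc t < length x →
    ∃ λ (u : List ℕ) → ∃ λ (a : ℕ) → ∃ λ (b : ℕ) → ∃ λ (v : List ℕ) → x ≡ u ++ a ∷ b ∷ v × length u ≡ t
  split-at zero    (a ∷ [])     (s≤s ())
  split-at zero    (a ∷ b ∷ v)  _        = [] , a , b , v , refl , refl
  split-at (suc t) (c ∷ x)      (s≤s lt) with split-at t x lt
  ... | u , a , b , v , refl , refl = c ∷ u , a , b , v , refl , refl

  desAt-split : ∀ u a b v → desAt (suc (length u)) (u ++ a ∷ b ∷ v) ≡ altDesAt (suc (length u)) a b
  desAt-split u a b v = cong₂ (altDesAt (suc (length u))) (nth-at u) (nth-next u)
    where
    nth-at : ∀ A → nth (A ++ a ∷ b ∷ v) (length A) ≡ a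
    nth-at []      = refl
    nth-at (c ∷ A) = nth-at A
    nth-next : ∀ A → nth (A ++ a ∷ b ∷ v) (suc (length A)) ≡ b
    nth-next []      = refl
    nth-next (c ∷ A) = nth-next A

  altdesIns-middle : ∀ t x → Unique x → (∀ {a} → a ∈ x → 1 ≤ a) → suc t < length x →
    altdesIns (suc t) (twist (suc t) x) + desAt (suc t) x ≡ altdes x + 2 * parity (suc t)
  altdesIns-middle t x uniq pos t< with split-at t x t<
  ... | u , a , b , v , refl , refl =
    trans (cong (altdesIns (suc (length u)) (twist (suc (length u)) (u ++ a ∷ b ∷ v)) +_) (desAt-split u a b v))
          (altdesIns-middle' u a b v uniq pos)

  desAt-complement : ∀ t x (f : ℕ → ℕ) → Unique x → (∀ {p q} → p ∈ x → q ∈ x → p < q → f q < f p) →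
    suc t < length x → desAt (suc t) (map f x) + desAt (suc t) x ≡ 1
  desAt-complement t x f uniq anti t< with split-at t x t<
  ... | u , a , b , v , refl , refl = begin
    desAt j (map f (u ++ a ∷ b ∷ v)) + desAt j (u ++ a ∷ b ∷ v)
      ≡⟨ cong₂ _+_ (cong (desAt j) (LP.map-++ f u (a ∷ b ∷ v))) (desAt-split u a b v) ⟩
    desAt j (map f u ++ f a ∷ f b ∷ map f v) + altDesAt j a b
      ≡⟨ cong (_+ altDesAt j a b) mapped ⟩
    altDesAt j (f a) (f b) + altDesAt j a b
      ≡⟨ cong (_+ altDesAt j a b) (altDesAt-anti j {f a} {f b} {a} {b} (proj₁ reversed) (proj₂ reversed)) ⟩
    altDesAt (suc j) a b + altDesAt j a b
      ≡⟨ NP.+-comm (altDesAt (suc j) a b) (altDesAt j a b) ⟩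
    altDesAt j a b + altDesAt (suc j) a b
      ≡⟨ altDesAt-flip j a≢b ⟩
    1 ∎
    where
    open ≡-Reasoning
    j = suc (length u)
    mapped : desAt j (map f u ++ f a ∷ f b ∷ map f v) ≡ altDesAt j (f a) (f b)
    mapped = trans (cong (λ z → desAt (suc z) (map f u ++ f a ∷ f b ∷ map f v)) (sym (LP.length-map f u)))
             (trans (desAt-split (map f u) (f a) (f b) (map f v)) (cong (λ z → altDesAt (suc z) (f a) (f b)) (LP.length-map f u)))
    a≢b : a ≢ b
    a≢b with unique-suffix u uniq
    ... | a∉ ∷ _ = All.lookup a∉ (here refl)
    a∈ = ∈-++⁺ʳ u (here refl)
    b∈ = ∈-++⁺ʳ u (there (here refl))
    reversed = anti-pair {f} a≢b (anti a∈ b∈) (anti b∈ a∈)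

  -- Kronecker delta δ a b = [a = b]; counts of permutations are sums of deltas.
  δ : ℕ → ℕ → ℕ
  δ a b = ind (a ≡ᵇ b)

  δ-yes : ∀ {a b} → a ≡ b → δ a b ≡ 1
  δ-yes {a} {b} e with a ≡ᵇ b in eq
  ... | true  = refl
  ... | false = ⊥-elim (subst T eq (NP.≡⇒≡ᵇ a b e))

  δ-no : ∀ {a b} → a ≢ b → δ a b ≡ 0
  δ-no {a} {b} ne with a ≡ᵇ b in eq
  ... | false = refl
  ... | true  = ⊥-elim (ne (NP.≡ᵇ⇒≡ a b (subst T (sym eq) tt)))

  δ-iff : ∀ {a b c d} → (a ≡ b → c ≡ d) → (c ≡ d → a ≡ b) → δ a b ≡ δ c d
  δ-iff {a} {b} {c} {d} f g with a N.≟ b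
  ... | yes e = trans (δ-yes e) (sym (δ-yes (f e)))
  ... | no ne = trans (δ-no ne) (sym (δ-no (λ e → ne (g e))))

  δ-sym : ∀ a b → δ a b ≡ δ b a
  δ-sym a b = δ-iff {a} {b} {b} {a} sym sym

  δ-cancel : ∀ a b c → δ (a + c) (b + c) ≡ δ a b
  δ-cancel a b c = δ-iff (NP.+-cancelʳ-≡ c a b) (cong (_+ c))

  δ-coef : ∀ {a b} c c' → (a ≡ b → c ≡ c') → c * δ a b ≡ c' * δ a b
  δ-coef {a} {b} c c' h with a N.≟ b
  ... | yes e = cong (_* δ a b) (h e)
  ... | no ne = trans (cong (c *_) (δ-no ne)) (trans (NP.*-zeroʳ c) (sym (trans (cong (c' *_) (δ-no ne)) (NP.*-zeroʳ c'))))

  -- In the insertion argument a position j contributes  δ r k + δ (r' + k) m,  where r, r' are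
  -- the alternating descents after inserting at j into w and into its complement
  -- (d = altdes w, d' = altdes of the complement, d + d' + 1 = m).

  -- End positions (j = 0 or j = m), where r = d + o and r' = d' + o for a bit o.
  end-contribution : ∀ m d d' o k → d + d' + 1 ≡ m → o ≤ 1 →
    δ (d + o) k + δ (d' + o + k) m ≡ δ k d + δ k (d + 1)
  end-contribution m d d' o k hm o≤1 = trans (cong (δ (d + o) k +_) complement-part) (bit o o≤1)
    where
    open ≡-Reasoning
    complement-part : δ (d' + o + k) m ≡ δ (o + k) (d + 1)
    complement-part = begin
      δ (d' + o + k) m              ≡⟨ cong₂ δ (rearrange₁ d' o k) (trans (sym hm) (rearrange₂ d d')) ⟩
      δ (o + k + d') (d + 1 + d')   ≡⟨ δ-cancel (o + k) (d + 1) d' ⟩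
      δ (o + k) (d + 1)             ∎
      where
      rearrange₁ : ∀ d' o k → d' + o + k ≡ o + k + d'
      rearrange₁ = solve-∀
      rearrange₂ : ∀ d d' → d + d' + 1 ≡ d + 1 + d'
      rearrange₂ = solve-∀
    bit : ∀ o → o ≤ 1 → δ (d + o) k + δ (o + k) (d + 1) ≡ δ k d + δ k (d + 1)
    bit zero          _ = cong₂ _+_ (trans (cong (λ z → δ z k) (NP.+-identityʳ d)) (δ-sym d k)) refl
    bit (suc zero)    _ = trans (cong₂ _+_ (δ-sym (d + 1) k) (trans (cong (λ z → δ z (d + 1)) (NP.+-comm 1 k)) (δ-cancel k d 1)))
                                (NP.+-comm (δ k (d + 1)) (δ k d))
    bit (suc (suc o)) (s≤s ())

  -- Inner positions, where r + e = d + 2o and r' + e' = d' + 2o with e + e' = 1: the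
  -- contribution only depends on the indicator e, not on the bit o.
  inner-contribution : ∀ m d d' r r' e e' o k → d + d' + 1 ≡ m → e + e' ≡ 1 →
    r + e ≡ d + 2 * o → r' + e' ≡ d' + 2 * o → o ≤ 1 →
    δ r k + δ (r' + k) m ≡ δ (k + e) d + δ (k + e) (d + 2)
  inner-contribution m d d' r r' e e' o k hm he hr hr' o≤1 =
    trans (cong₂ _+_ own-part complement-part) (bit o o≤1)
    where
    open ≡-Reasoning
    own-part : δ r k ≡ δ (d + 2 * o) (k + e)
    own-part = trans (sym (δ-cancel r k e)) (cong (λ z → δ z (k + e)) hr)
    complement-part : δ (r' + k) m ≡ δ (2 * o + (k + e)) (d + 2)
    complement-part = begin
      δ (r' + k) m                                ≡⟨ sym (δ-cancel (r' + k) m 1) ⟩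
      δ (r' + k + 1) (m + 1)                      ≡⟨ cong₂ δ (cong (r' + k +_) (sym he)) (cong (_+ 1) (sym hm)) ⟩
      δ (r' + k + (e + e')) (d + d' + 1 + 1)      ≡⟨ cong₂ δ (rearrange₁ r' k e e') (rearrange₂ d d') ⟩
      δ ((r' + e') + (k + e)) (d + 2 + d')        ≡⟨ cong (λ z → δ (z + (k + e)) (d + 2 + d')) hr' ⟩
      δ ((d' + 2 * o) + (k + e)) (d + 2 + d')     ≡⟨ cong (λ z → δ z (d + 2 + d')) (rearrange₃ d' (2 * o) (k + e)) ⟩
      δ (2 * o + (k + e) + d') (d + 2 + d')       ≡⟨ δ-cancel (2 * o + (k + e)) (d + 2) d' ⟩
      δ (2 * o + (k + e)) (d + 2)                 ∎
      where
      rearrange₁ : ∀ r' k e e' → r' + k + (e + e') ≡ (r' + e') + (k + e)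
      rearrange₁ = solve-∀
      rearrange₂ : ∀ d d' → d + d' + 1 + 1 ≡ d + 2 + d'
      rearrange₂ = solve-∀
      rearrange₃ : ∀ d' o x → d' + o + x ≡ o + x + d'
      rearrange₃ = solve-∀
    bit : ∀ o → o ≤ 1 → δ (d + 2 * o) (k + e) + δ (2 * o + (k + e)) (d + 2) ≡ δ (k + e) d + δ (k + e) (d + 2)
    bit zero          _ = cong (_+ δ (k + e) (d + 2)) (trans (cong (λ z → δ z (k + e)) (NP.+-identityʳ d)) (δ-sym d (k + e)))
    bit (suc zero)    _ = trans (cong₂ _+_ (δ-sym (d + 2) (k + e))
                                           (trans (cong (λ z → δ z (d + 2)) (NP.+-comm 2 (k + e))) (δ-cancel (k + e) d 2)))
                                (NP.+-comm (δ (k + e) (d + 2)) (δ (k + e) d))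
    bit (suc (suc o)) (s≤s ())

  inner₁ inner₀ : ℕ → ℕ → ℕ
  inner₁ d k = δ (k + 1) d + δ k (d + 1)
  inner₀ d k = δ k d + δ k (d + 2)

  inner-bit : ∀ d k e → e ≤ 1 → δ (k + e) d + δ (k + e) (d + 2) ≡ inner₁ d k * e + inner₀ d k * (1 ∸ e)
  inner-bit d k zero          _ = begin
    δ (k + 0) d + δ (k + 0) (d + 2)    ≡⟨ cong (λ z → δ z d + δ z (d + 2)) (NP.+-identityʳ k) ⟩
    inner₀ d k                         ≡⟨ sym (cong₂ _+_ (NP.*-zeroʳ (inner₁ d k)) (NP.*-identityʳ (inner₀ d k))) ⟩
    inner₁ d k * 0 + inner₀ d k * 1    ∎
    where open ≡-Reasoning
  inner-bit d k (suc zero)    _ = begin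
    δ (k + 1) d + δ (k + 1) (d + 2)    ≡⟨ cong (δ (k + 1) d +_) shifted ⟩
    inner₁ d k                         ≡⟨ sym (trans (cong₂ _+_ (NP.*-identityʳ (inner₁ d k)) (NP.*-zeroʳ (inner₀ d k))) (NP.+-identityʳ (inner₁ d k))) ⟩
    inner₁ d k * 1 + inner₀ d k * 0    ∎
    where
    open ≡-Reasoning
    shifted : δ (k + 1) (d + 2) ≡ δ k (d + 1)
    shifted = trans (cong (δ (k + 1)) (sym (NP.+-assoc d 1 1))) (δ-cancel k (d + 1) 1)
  inner-bit d k (suc (suc e)) (s≤s ())

  oneTo-unique : ∀ m → Unique (oneTo m)
  oneTo-unique m = UP.map⁺ NP.suc-injective (UP.upTo⁺ m)

  oneTo-∈⁻ : ∀ {m a} → a ∈ oneTo m → 1 ≤ a × a ≤ m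
  oneTo-∈⁻ {m} p with ∈-map⁻ suc p
  ... | i , i∈ , refl = s≤s z≤n , ∈-upTo⁻ i∈

  oneTo-∈⁺ : ∀ {m a} → 1 ≤ a → a ≤ m → a ∈ oneTo m
  oneTo-∈⁺ {m} {suc a} _ le = ∈-map⁺ suc (∈-upTo⁺ le)

  length-oneTo : ∀ m → length (oneTo m) ≡ m
  length-oneTo m = trans (LP.length-map suc (upTo m)) (LP.length-upTo m)

  oneTo-suc : ∀ m → oneTo (suc m) ≡ 1 ∷ map suc (oneTo m)
  oneTo-suc m = cong (1 ∷_) (cong (map suc) (sym (LP.map-applyUpTo (λ x → x) suc m)))

  Sym-↭ : ∀ {m w} → w ∈ Sym m → w ↭ oneTo m
  Sym-↭ {m} = perms-↭ (oneTo m)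

  ↭-Sym : ∀ {m w} → w ↭ oneTo m → w ∈ Sym m
  ↭-Sym {m} = ↭-perms (oneTo m)

  Sym-unique : ∀ m → Unique (Sym m)
  Sym-unique m = perms-unique (oneTo m) (oneTo-unique m)

  Sym-w-unique : ∀ {m w} → w ∈ Sym m → Unique w
  Sym-w-unique {m} w∈ = unique-resp-↭ (↭-sym (Sym-↭ {m} w∈)) (oneTo-unique m)

  Sym-w-range : ∀ {m w} → w ∈ Sym m → ∀ {a} → a ∈ w → 1 ≤ a × a ≤ m
  Sym-w-range {m} w∈ a∈ = oneTo-∈⁻ (∈-resp-↭ (Sym-↭ {m} w∈) a∈)

  Sym-w-length : ∀ {m w} → w ∈ Sym m → length w ≡ m
  Sym-w-length {m} w∈ = trans (↭-length (Sym-↭ {m} w∈)) (length-oneTo m)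

  Sym-involution : ∀ m (φ : List ℕ → List ℕ) → (∀ {w} → w ↭ oneTo m → φ w ↭ oneTo m) →
    (∀ {w} → w ∈ Sym m → φ (φ w) ≡ w) → (f : List ℕ → ℕ) → ΣL (Sym m) f ≡ ΣL (Sym m) (f ∘ φ)
  Sym-involution m φ closed invol f =
    trans (sym (ΣL-↭ f (involution-↭ φ (Sym-unique m) (λ w∈ → ↭-Sym {m} (closed (Sym-↭ {m} w∈))) invol)))
          (ΣL-map φ (Sym m) f)

  flip : ℕ → ℕ → ℕ
  flip m a = suc m ∸ a

  flip-invol : ∀ m {a} → a ≤ suc m → flip m (flip m a) ≡ a
  flip-invol m le = NP.m∸[m∸n]≡n le

  flip-range : ∀ m {a} → 1 ≤ a → a ≤ m → 1 ≤ flip m a × flip m a ≤ m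
  flip-range m {a} h le = NP.m<n⇒0<n∸m (s≤s le) , NP.∸-monoʳ-≤ {1} {a} (suc m) h

  flip-anti : ∀ m {a b} → b ≤ m → a < b → flip m b < flip m a
  flip-anti m {a} {b} bm ab = NP.∸-monoʳ-< ab (NP.≤-trans bm (NP.n≤1+n m))

  flip-oneTo : ∀ m → map (flip m) (oneTo m) ↭ oneTo m
  flip-oneTo m = involution-↭ (flip m) (oneTo-unique m)
    (λ a∈ → let r = oneTo-∈⁻ a∈ ; c = flip-range m (proj₁ r) (proj₂ r) in oneTo-∈⁺ (proj₁ c) (proj₂ c))
    (λ a∈ → flip-invol m (NP.≤-trans (proj₂ (oneTo-∈⁻ a∈)) (NP.n≤1+n m)))

  complement : ℕ → List ℕ → List ℕ
  complement m w = map (flip m) w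

  complement-↭ : ∀ m {w} → w ↭ oneTo m → complement m w ↭ oneTo m
  complement-↭ m p = ↭-trans (map⁺ (flip m) p) (flip-oneTo m)

  complement-invol : ∀ m {w} → w ∈ Sym m → complement m (complement m w) ≡ w
  complement-invol m {w} w∈ = trans (sym (LP.map-∘ w)) (LP.map-id-local (All.tabulate (λ a∈ →
    flip-invol m (NP.≤-trans (proj₂ (Sym-w-range {m} w∈ a∈)) (NP.n≤1+n m)))))

  complement-anti : ∀ m {w} → w ∈ Sym m → ∀ {p q} → p ∈ w → q ∈ w → p < q → flip m q < flip m p
  complement-anti m w∈ p∈ q∈ p<q = flip-anti m (proj₂ (Sym-w-range {m} w∈ q∈)) p<q

  altdes-complement : ∀ m {w} → w ∈ Sym m → altdes w + altdes (complement m w) ≡ m ∸ 1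
  altdes-complement m {w} w∈ =
    trans (cong (altdes w +_) (altdes-anti 1 w (flip m) (Sym-w-unique {m} w∈) (complement-anti m w∈)))
          (trans (altdes-flip 1 w (Sym-w-unique {m} w∈)) (cong (_∸ 1) (Sym-w-length {m} w∈)))

  twist-↭ : ∀ j w → Unique w → twist j w ↭ w
  twist-↭ j w u = ↭-trans (++⁺ˡ (take j w) (reflect-↭ (drop j w) (UP.drop⁺ j u))) (↭-reflexive (LP.take++drop≡id j w))

  twist-invol : ∀ j w → Unique w → j ≤ length w → twist j (twist j w) ≡ w
  twist-invol j w u le = begin
    twist j (take j w ++ reflect (drop j w))              ≡⟨ cong (λ i → twist i (take j w ++ reflect (drop j w))) (sym length-take) ⟩
    twist (length (take j w)) (take j w ++ reflect (drop j w)) ≡⟨ twist-++ (take j w) (reflect (drop j w)) ⟩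
    take j w ++ reflect (reflect (drop j w))              ≡⟨ cong (take j w ++_) (reflect-invol (drop j w) (UP.drop⁺ j u)) ⟩
    take j w ++ drop j w                                  ≡⟨ LP.take++drop≡id j w ⟩
    w                                                     ∎
    where
    open ≡-Reasoning
    length-take : length (take j w) ≡ j
    length-take = trans (LP.length-take j w) (NP.m≤n⇒m⊓n≡m le)

  insertions-map : ∀ (f : ℕ → ℕ) x ys → insertions (f x) (map f ys) ≡ map (map f) (insertions x ys)
  insertions-map f x []       = refl
  insertions-map f x (y ∷ ys) = cong ((f x ∷ f y ∷ map f ys) ∷_)
    (trans (cong (map (f y ∷_)) (insertions-map f x ys))
           (trans (sym (LP.map-∘ (insertions x ys))) (LP.map-∘ (insertions x ys))))

  perms-map : ∀ (f : ℕ → ℕ) xs → perms (map f xs) ≡ map (map f) (perms xs)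
  perms-map f []       = refl
  perms-map f (x ∷ xs) = begin
    concatMap (insertions (f x)) (perms (map f xs))        ≡⟨ cong (concatMap (insertions (f x))) (perms-map f xs) ⟩
    concatMap (insertions (f x)) (map (map f) (perms xs))  ≡⟨ LP.concatMap-map (insertions (f x)) (map f) (perms xs) ⟩
    concatMap (insertions (f x) ∘ map f) (perms xs)        ≡⟨ LP.concatMap-cong (insertions-map f x) (perms xs) ⟩
    concatMap (map (map f) ∘ insertions x) (perms xs)      ≡⟨ sym (LP.map-concatMap (map f) (insertions x) (perms xs)) ⟩
    map (map f) (concatMap (insertions x) (perms xs))      ∎
    where open ≡-Reasoning

  Sym-suc : ∀ m → Sym (suc m) ≡ concatMap (insertions 1) (map (map suc) (Sym m))
  Sym-suc m = trans (cong perms (oneTo-suc m)) (cong (concatMap (insertions 1)) (perms-map suc (oneTo m)))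

  ΣL-insertions : ∀ y ys (g : List ℕ → ℕ) → ΣL (insertions y ys) g ≡ Σ< (suc (length ys)) (λ j → g (insertAt j y ys))
  ΣL-insertions y []       g = refl
  ΣL-insertions y (z ∷ zs) g = cong (g (y ∷ z ∷ zs) +_)
    (trans (ΣL-map (z ∷_) (insertions y zs) g) (ΣL-insertions y zs (g ∘ (z ∷_))))

  -- Summing over 𝔖_{m+1} = summing over w ∈ 𝔖_m and insertion positions j ≤ m;
  -- for each fixed j, w may be replaced by its twist since twisting permutes 𝔖_m.
  sum-Sym-suc : ∀ m (g : List ℕ → ℕ) →
    ΣL (Sym (suc m)) g ≡ ΣL (Sym m) (λ w → Σ< (suc m) (λ j → g (insertAt j 1 (map suc (twist j w)))))
  sum-Sym-suc m g = begin
    ΣL (Sym (suc m)) g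
      ≡⟨ cong (λ z → ΣL z g) (Sym-suc m) ⟩
    ΣL (concatMap (insertions 1) (map (map suc) (Sym m))) g
      ≡⟨ trans (ΣL-concatMap (insertions 1) (map (map suc) (Sym m)) g) (ΣL-map (map suc) (Sym m) _) ⟩
    ΣL (Sym m) (λ w → ΣL (insertions 1 (map suc w)) g)
      ≡⟨ ΣL-cong (Sym m) (λ {w} w∈ → trans (ΣL-insertions 1 (map suc w) g)
           (cong (λ z → Σ< (suc z) (λ j → g (insertAt j 1 (map suc w)))) (trans (LP.length-map suc w) (Sym-w-length {m} w∈)))) ⟩
    ΣL (Sym m) (λ w → Σ< (suc m) (λ j → g (insertAt j 1 (map suc w))))
      ≡⟨ ΣL-Σ< (Sym m) (suc m) (λ w j → g (insertAt j 1 (map suc w))) ⟩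
    Σ< (suc m) (λ j → ΣL (Sym m) (λ w → g (insertAt j 1 (map suc w))))
      ≡⟨ Σ<-cong< (suc m) (λ j j≤m → Sym-involution m (twist j)
           (λ p → ↭-trans (twist-↭ j _ (unique-resp-↭ (↭-sym p) (oneTo-unique m))) p)
           (λ {w} w∈ → twist-invol j w (Sym-w-unique {m} w∈) (subst (j ≤_) (sym (Sym-w-length {m} w∈)) (NP.≤-pred j≤m)))
           (λ w → g (insertAt j 1 (map suc w)))) ⟩
    Σ< (suc m) (λ j → ΣL (Sym m) (λ w → g (insertAt j 1 (map suc (twist j w)))))
      ≡⟨ sym (ΣL-Σ< (Sym m) (suc m) (λ w j → g (insertAt j 1 (map suc (twist j w))))) ⟩
    ΣL (Sym m) (λ w → Σ< (suc m) (λ j → g (insertAt j 1 (map suc (twist j w))))) ∎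
    where open ≡-Reasoning

  -- The total contribution of all insertion positions j ≤ m for a w ∈ 𝔖_m with d
  -- alternating descents (InsertionSum.insertion-sum): d inner positions with indicator 1,
  -- m-1-d inner positions with indicator 0, and the two end positions.
  insertionCount : ℕ → ℕ → ℕ → ℕ
  insertionCount m d k = inner₁ d k * d + inner₀ d k * (m ∸ 1 ∸ d) + 2 * (δ k d + δ k (d + 1))

  module InsertionSum (m' k : ℕ) {w : List ℕ} (w∈ : w ∈ Sym (suc m')) where

    m : ℕ
    m = suc m'

    cw : List ℕ
    cw = complement m w

    d d' : ℕ
    d  = altdes w
    d' = altdes cw

    cw∈ : cw ∈ Sym m
    cw∈ = ↭-Sym {m} (complement-↭ m (Sym-↭ {m} w∈))

    altdes-sum : d + d' + 1 ≡ m
    altdes-sum = trans (cong (_+ 1) (altdes-complement m w∈)) (NP.+-comm m' 1)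

    contribution : ℕ → ℕ
    contribution j = δ (altdesIns j (twist j w)) k + δ (altdesIns j (twist j cw) + k) m

    first-position : contribution 0 ≡ δ k d + δ k (d + 1)
    first-position = begin
      contribution 0        ≡⟨ cong₂ (λ x y → δ x k + δ (y + k) m)
                                     (trans (altdesIns-first w (Sym-w-unique {m} w∈)) (sym (NP.+-identityʳ d)))
                                     (trans (altdesIns-first cw (Sym-w-unique {m} cw∈)) (sym (NP.+-identityʳ d'))) ⟩
      δ (d + 0) k + δ (d' + 0 + k) m  ≡⟨ end-contribution m d d' 0 k altdes-sum z≤n ⟩
      δ k d + δ k (d + 1)   ∎
      where open ≡-Reasoning

    last-position : contribution m ≡ δ k d + δ k (d + 1)
    last-position = trans (cong₂ (λ x y → δ x k + δ (y + k) m) (at-end w∈) (at-end cw∈))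
                          (end-contribution m d d' (parity m) k altdes-sum (parity≤1 m))
      where
      at-end : ∀ {x} → x ∈ Sym m → altdesIns m (twist m x) ≡ altdes x + parity m
      at-end {[]}    x∈ = ⊥-elim (NP.0≢1+n (Sym-w-length {m} x∈))
      at-end {a ∷ x} x∈ = subst (λ z → altdesIns z (twist z (a ∷ x)) ≡ altdes (a ∷ x) + parity z)
                                (Sym-w-length {m} x∈) (altdesIns-last a x (λ c∈ → proj₁ (Sym-w-range {m} x∈ c∈)))

    -- Inner positions: by inner-contribution only the indicator e_t = desAt (t+1) w matters,
    -- and d of the m' indicators are 1.
    inner-positions : Σ< m' (λ t → contribution (suc t)) ≡ inner₁ d k * d + inner₀ d k * (m' ∸ d)
    inner-positions = begin
      Σ< m' (λ t → contribution (suc t))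
        ≡⟨ Σ<-cong< m' (λ t t<m' → trans (at-inner t (s≤s t<m')) (inner-bit d k (e t) (desAt≤1 (suc t) w))) ⟩
      Σ< m' (λ t → inner₁ d k * e t + inner₀ d k * (1 ∸ e t))
        ≡⟨ Σ<-add m' (λ t → inner₁ d k * e t) (λ t → inner₀ d k * (1 ∸ e t)) ⟩
      Σ< m' (λ t → inner₁ d k * e t) + Σ< m' (λ t → inner₀ d k * (1 ∸ e t))
        ≡⟨ cong₂ _+_ (Σ<-mul m' (inner₁ d k) e) (Σ<-mul m' (inner₀ d k) (λ t → 1 ∸ e t)) ⟩
      inner₁ d k * Σ< m' e + inner₀ d k * Σ< m' (λ t → 1 ∸ e t)
        ≡⟨ cong₂ (λ x y → inner₁ d k * x + inner₀ d k * y) Σe (Σ<-complement m' e d (λ t → desAt≤1 (suc t) w) Σe) ⟩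
      inner₁ d k * d + inner₀ d k * (m' ∸ d) ∎
      where
      open ≡-Reasoning
      e : ℕ → ℕ
      e t = desAt (suc t) w
      Σe : Σ< m' e ≡ d
      Σe = trans (cong (λ z → Σ< z e) (sym (cong (_∸ 1) (Sym-w-length {m} w∈)))) (Σ-desAt w)
      inside : ∀ {x} → x ∈ Sym m → ∀ {t} → suc t < m → suc t < length x
      inside x∈ t<m = subst (_ <_) (sym (Sym-w-length {m} x∈)) t<m
      middle : ∀ {x} → x ∈ Sym m → ∀ t → suc t < m →
        altdesIns (suc t) (twist (suc t) x) + desAt (suc t) x ≡ altdes x + 2 * parity (suc t)
      middle x∈ t t<m = altdesIns-middle t _ (Sym-w-unique {m} x∈) (λ c∈ → proj₁ (Sym-w-range {m} x∈ c∈)) (inside x∈ t<m)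
      at-inner : ∀ t → suc t < m → contribution (suc t) ≡ δ (k + e t) d + δ (k + e t) (d + 2)
      at-inner t t<m = inner-contribution m d d' _ _ (e t) (desAt (suc t) cw) (parity (suc t)) k altdes-sum
        (trans (NP.+-comm (e t) (desAt (suc t) cw))
               (desAt-complement t w (flip m) (Sym-w-unique {m} w∈) (complement-anti m w∈) (inside w∈ t<m)))
        (middle w∈ t t<m) (middle cw∈ t t<m) (parity≤1 (suc t))

    insertion-sum : Σ< (suc m) contribution ≡ insertionCount m d k
    insertion-sum = begin
      contribution 0 + Σ< m (λ t → contribution (suc t))
        ≡⟨ cong (contribution 0 +_) (Σ<-snoc m' (λ t → contribution (suc t))) ⟩
      contribution 0 + (Σ< m' (λ t → contribution (suc t)) + contribution m)
        ≡⟨ cong₂ (λ x y → x + y) first-position (cong₂ _+_ inner-positions last-position) ⟩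
      ends + ((inner₁ d k * d + inner₀ d k * (m' ∸ d)) + ends)
        ≡⟨ regroup ends (inner₁ d k * d) (inner₀ d k * (m' ∸ d)) ⟩
      insertionCount m d k ∎
      where
      open ≡-Reasoning
      ends = δ k d + δ k (d + 1)
      regroup : ∀ E X Y → E + ((X + Y) + E) ≡ X + Y + 2 * E
      regroup = solve-∀

  -- A(m,k) as a sum of deltas, and its shifts  Ashift m c k = A(m, k-c)  (0 when k < c).
  Acount : ℕ → ℕ → ℕ
  Acount m k = ΣL (Sym m) (λ w → δ (altdes w) k)

  Ashift : ℕ → ℕ → ℕ → ℕ
  Ashift m c k = ΣL (Sym m) (λ w → δ (altdes w + c) k)

  altEuler≡Acount : ∀ m k → altEuler m k ≡ Acount m k
  altEuler≡Acount m k = length-filter (λ π → altdes π ≡ᵇ k) (Sym m)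
    where
    length-filter : ∀ (p : List ℕ → Bool) xs → length (filterᵇ p xs) ≡ ΣL xs (λ x → ind (p x))
    length-filter p []       = refl
    length-filter p (x ∷ xs) with p x
    ... | true  = cong suc (length-filter p xs)
    ... | false = length-filter p xs

  altdes≤ : ∀ m' {w} → w ∈ Sym (suc m') → altdes w ≤ m'
  altdes≤ m' {w} w∈ = subst (altdes w ≤_) (altdes-complement (suc m') w∈) (NP.m≤m+n (altdes w) _)

  complement-symmetry : ∀ m k → Acount (suc m) k ≡ ΣL (Sym (suc m)) (λ π → δ (altdes π + k) m)
  complement-symmetry m k =
    trans (Sym-involution (suc m) (complement (suc m)) (complement-↭ (suc m)) (complement-invol (suc m)) (λ π → δ (altdes π) k))
          (ΣL-cong (Sym (suc m)) (λ {π} π∈ → δ-iff (λ e → trans (cong (altdes π +_) (sym e)) (sums π∈))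
                                                 (λ e → NP.+-cancelˡ-≡ (altdes π) _ _ (trans (sums π∈) (sym e)))))
    where
    sums : ∀ {π} → π ∈ Sym (suc m) → altdes π + altdes (complement (suc m) π) ≡ m
    sums = altdes-complement (suc m)

  -- insertionCount rearranged by the value of k - d ∈ {-1, 0, 1, 2}.
  insertionCount-expand : ∀ m' d k → d ≤ m' → insertionCount (suc m') d k
    ≡ (k + 1) * δ d (k + 1) + (k + 1) * δ (d + 1) k + (suc (suc m') ∸ k) * δ d k + (suc (suc m') ∸ k) * δ (d + 2) k
  insertionCount-expand m' d k d≤m' = begin
    insertionCount (suc m') d k
      ≡⟨ expand d (δ (k + 1) d) (δ k (d + 1)) (δ k d) (δ k (d + 2)) (m' ∸ d) ⟩
    d * δ (k + 1) d + (d + 2) * δ k (d + 1) + (m' ∸ d + 2) * δ k d + (m' ∸ d) * δ k (d + 2)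
      ≡⟨ cong₂ _+_ (cong₂ _+_ (cong₂ _+_ term₁ term₂) term₃) term₄ ⟩
    (k + 1) * δ d (k + 1) + (k + 1) * δ (d + 1) k + (suc (suc m') ∸ k) * δ d k + (suc (suc m') ∸ k) * δ (d + 2) k ∎
    where
    open ≡-Reasoning
    expand : ∀ d A B C D M → (A + B) * d + (C + D) * M + 2 * (C + B) ≡ d * A + (d + 2) * B + (M + 2) * C + M * D
    expand = solve-∀
    term₁ : d * δ (k + 1) d ≡ (k + 1) * δ d (k + 1)
    term₁ = trans (cong (d *_) (δ-sym (k + 1) d)) (δ-coef {d} {k + 1} d (k + 1) (λ e → e))
    term₂ : (d + 2) * δ k (d + 1) ≡ (k + 1) * δ (d + 1) k
    term₂ = trans (cong ((d + 2) *_) (δ-sym k (d + 1)))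
                  (δ-coef {d + 1} {k} (d + 2) (k + 1) (λ e → trans (sym (NP.+-assoc d 1 1)) (cong (_+ 1) e)))
    term₃ : (m' ∸ d + 2) * δ k d ≡ (suc (suc m') ∸ k) * δ d k
    term₃ = trans (cong ((m' ∸ d + 2) *_) (δ-sym k d)) (δ-coef {d} {k} (m' ∸ d + 2) (suc (suc m') ∸ k)
      (λ { refl → trans (NP.+-comm (m' ∸ d) 2) (sym (NP.+-∸-assoc 2 d≤m')) }))
    term₄ : (m' ∸ d) * δ k (d + 2) ≡ (suc (suc m') ∸ k) * δ (d + 2) k
    term₄ = trans (cong ((m' ∸ d) *_) (δ-sym k (d + 2))) (δ-coef {d + 2} {k} (m' ∸ d) (suc (suc m') ∸ k)
      (λ e → sym (trans (cong (suc (suc m') ∸_) (sym e)) (cong (suc (suc m') ∸_) (NP.+-comm d 2)))))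

  ΣL-linear₄ : ∀ {A : Set} (xs : List A) a b c e (f g h i : A → ℕ) →
    ΣL xs (λ x → a * f x + b * g x + c * h x + e * i x) ≡ a * ΣL xs f + b * ΣL xs g + c * ΣL xs h + e * ΣL xs i
  ΣL-linear₄ xs a b c e f g h i = begin
    ΣL xs (λ x → a * f x + b * g x + c * h x + e * i x)
      ≡⟨ ΣL-add xs (λ x → a * f x + b * g x + c * h x) (λ x → e * i x) ⟩
    ΣL xs (λ x → a * f x + b * g x + c * h x) + ΣL xs (λ x → e * i x)
      ≡⟨ cong (_+ ΣL xs (λ x → e * i x)) (trans (ΣL-add xs (λ x → a * f x + b * g x) (λ x → c * h x))
                                                  (cong (_+ ΣL xs (λ x → c * h x)) (ΣL-add xs (λ x → a * f x) (λ x → b * g x)))) ⟩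
    ΣL xs (λ x → a * f x) + ΣL xs (λ x → b * g x) + ΣL xs (λ x → c * h x) + ΣL xs (λ x → e * i x)
      ≡⟨ cong₂ _+_ (cong₂ _+_ (cong₂ _+_ (ΣL-mul xs a f) (ΣL-mul xs b g)) (ΣL-mul xs c h)) (ΣL-mul xs e i) ⟩
    a * ΣL xs f + b * ΣL xs g + c * ΣL xs h + e * ΣL xs i ∎
    where open ≡-Reasoning

  -- Count A(m+1,k) once directly and once through complements, decompose 𝔖_{m+1} by
  -- insertion of 1, and evaluate the inner sums with insertion-sum.
  Acount-rec : ∀ m' k → 2 * Acount (suc (suc m')) k ≡
    (k + 1) * Acount (suc m') (k + 1) + (k + 1) * Ashift (suc m') 1 k
      + (suc (suc m') ∸ k) * Acount (suc m') k + (suc (suc m') ∸ k) * Ashift (suc m') 2 k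
  Acount-rec m' k = begin
    2 * Acount (suc m) k
      ≡⟨ cong (Acount (suc m) k +_) (trans (NP.+-identityʳ _) (complement-symmetry m k)) ⟩
    Acount (suc m) k + ΣL (Sym (suc m)) (λ π → δ (altdes π + k) m)
      ≡⟨ cong₂ _+_ (sum-Sym-suc m (λ π → δ (altdes π) k))
                   (trans (sum-Sym-suc m (λ π → δ (altdes π + k) m))
                          (Sym-involution m (complement m) (complement-↭ m) (complement-invol m) inserted-complement)) ⟩
    ΣL (Sym m) inserted + ΣL (Sym m) (inserted-complement ∘ complement m)
      ≡⟨ sym (ΣL-add (Sym m) inserted (inserted-complement ∘ complement m)) ⟩
    ΣL (Sym m) (λ w → inserted w + inserted-complement (complement m w))
      ≡⟨ ΣL-cong (Sym m) (λ {w} w∈ → trans (sym (Σ<-add (suc m) (λ j → δ (altdesIns j (twist j w)) k) (λ j → δ (altdesIns j (twist j (complement m w)) + k) m)))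
                                          (trans (InsertionSum.insertion-sum m' k w∈) (insertionCount-expand m' (altdes w) k (altdes≤ m' w∈)))) ⟩
    ΣL (Sym m) (λ w → (k + 1) * δ (altdes w) (k + 1) + (k + 1) * δ (altdes w + 1) k
                      + (suc m ∸ k) * δ (altdes w) k + (suc m ∸ k) * δ (altdes w + 2) k)
      ≡⟨ ΣL-linear₄ (Sym m) (k + 1) (k + 1) (suc m ∸ k) (suc m ∸ k)
                    (λ w → δ (altdes w) (k + 1)) (λ w → δ (altdes w + 1) k) (λ w → δ (altdes w) k) (λ w → δ (altdes w + 2) k) ⟩
    (k + 1) * Acount m (k + 1) + (k + 1) * Ashift m 1 k + (suc m ∸ k) * Acount m k + (suc m ∸ k) * Ashift m 2 k ∎
    where
    open ≡-Reasoning
    m = suc m'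
    inserted inserted-complement : List ℕ → ℕ
    inserted            w = Σ< (suc m) (λ j → δ (altdesIns j (twist j w)) k)
    inserted-complement w = Σ< (suc m) (λ j → δ (altdesIns j (twist j w) + k) m)

open import Defs
open import Data.Nat as N using (ℕ; zero; suc; _≤_; _^_; s≤s; z≤n)
import Data.Nat.Properties as NP
open import Data.Nat.Tactic.RingSolver using (solve-∀)
open import Data.Integer using (+_; _+_; _*_; _-_)
import Data.Integer.Properties as ZP
open import Relation.Binary.PropositionalEquality
open import Relation.Nullary using (yes; no)
open Coefficients using (Seq; shift; shift-cong; T; T-cong; R; R-rec; rhsSum≡R)
open Counting using (δ; δ-no; ΣL-cong; ΣL-zero; Acount; Ashift; altEuler≡Acount; Acount-rec; altdes≤)

Ashift-0 : ∀ m k → Ashift m 0 k ≡ Acount m k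
Ashift-0 m k = ΣL-cong (Sym m) (λ {w} _ → cong (λ z → δ z k) (NP.+-identityʳ (altdes w)))

Ashift-suc : ∀ m c k → Ashift m (suc c) (suc k) ≡ Ashift m c k
Ashift-suc m c k = ΣL-cong (Sym m) (λ {w} _ → cong (λ z → δ z (suc k)) (NP.+-suc (altdes w) c))

Ashift-below : ∀ m c k → k N.< c → Ashift m c k ≡ 0
Ashift-below m c k k<c = ΣL-zero (Sym m) (λ w → δ (altdes w N.+ c) k)
  (λ {w} _ → δ-no (λ e → NP.<⇒≱ k<c (subst (c ≤_) e (NP.m≤n+m c (altdes w)))))

Ashift-above : ∀ n c k → n N.+ c N.< k → Ashift (suc n) c k ≡ 0
Ashift-above n c k n+c<k = ΣL-zero (Sym (suc n)) (λ w → δ (altdes w N.+ c) k)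
  (λ {w} w∈ → δ-no (λ e → NP.<-irrefl e (NP.≤-<-trans (NP.+-monoˡ-≤ c (altdes≤ n w∈)) n+c<k)))

shift-Ashift : ∀ P m c s → shift (λ t → + (P N.* Ashift m c t)) s ≡ + (P N.* Ashift m (suc c) s)
shift-Ashift P m c zero    = sym (trans (cong (λ z → + (P N.* z)) (Ashift-below m (suc c) 0 (s≤s z≤n))) (cong +_ (NP.*-zeroʳ P)))
shift-Ashift P m c (suc s) = cong (λ z → + (P N.* z)) (sym (Ashift-suc m c s))

shift-Acount : ∀ P m s → shift (λ t → + (P N.* Acount m t)) s ≡ + (P N.* Ashift m 1 s)
shift-Acount P m s = trans (shift-cong (λ t → cong (λ z → + (P N.* z)) (sym (Ashift-0 m t))) s) (shift-Ashift P m 0 s)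

-- The integer coefficient a - s of T may be truncated to a ∸ s when it multiplies
-- a quantity that vanishes for s > a.
truncated-coefficient : ∀ a s x → (a N.< s → x ≡ 0) → (+ a - + s) * + x ≡ + ((a N.∸ s) N.* x)
truncated-coefficient a s x vanish with s N.≤? a
... | yes s≤a = trans (cong (_* + x) (trans (ZP.m-n≡m⊖n a s) (ZP.⊖-≥ s≤a))) (sym (ZP.pos-* (a N.∸ s) x))
... | no  s≰a rewrite vanish (NP.≰⇒> s≰a) = trans (ZP.*-zeroʳ (+ a - + s)) (cong +_ (sym (NP.*-zeroʳ (a N.∸ s))))

counted : ℕ → Seq
counted n s = + (2 ^ n N.* Acount (suc n) s)

module _ (n s : ℕ) where

  private
    K : ℕ
    K = 2 ^ n
    A A₁ A₂ : ℕ → ℕ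
    A  = Acount (suc n)
    A₁ = Ashift (suc n) 1
    A₂ = Ashift (suc n) 2

  -- T n on the count sequence, as a natural number (for s > n+2 both counts vanish).
  T-counted : T n (counted n) s
    ≡ + (suc s N.* (K N.* A (suc s) N.+ K N.* A₁ s) N.+ (2 N.+ n N.∸ s) N.* (K N.* A s N.+ K N.* A₂ s))
  T-counted = begin
    + suc s * (counted n (suc s) + shift (counted n) s) + (+ (2 N.+ n) - + s) * (counted n s + shift (shift (counted n)) s)
      ≡⟨ cong₂ (λ x y → + suc s * (counted n (suc s) + x) + (+ (2 N.+ n) - + s) * (counted n s + y))
               (shift-Acount K (suc n) s)
               (trans (shift-cong (shift-Acount K (suc n)) s) (shift-Ashift K (suc n) 1 s)) ⟩
    + suc s * (+ (K N.* A (suc s)) + + (K N.* A₁ s)) + (+ (2 N.+ n) - + s) * (+ (K N.* A s) + + (K N.* A₂ s))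
      ≡⟨ sym (cong₂ (λ x y → + suc s * x + (+ (2 N.+ n) - + s) * y) (ZP.pos-+ (K N.* A (suc s)) _) (ZP.pos-+ (K N.* A s) _)) ⟩
    + suc s * + (K N.* A (suc s) N.+ K N.* A₁ s) + (+ (2 N.+ n) - + s) * + (K N.* A s N.+ K N.* A₂ s)
      ≡⟨ cong₂ _+_ (sym (ZP.pos-* (suc s) _)) (truncated-coefficient (2 N.+ n) s _ vanish) ⟩
    + (suc s N.* (K N.* A (suc s) N.+ K N.* A₁ s)) + + ((2 N.+ n N.∸ s) N.* (K N.* A s N.+ K N.* A₂ s))
      ≡⟨ sym (ZP.pos-+ (suc s N.* (K N.* A (suc s) N.+ K N.* A₁ s)) _) ⟩
    + (suc s N.* (K N.* A (suc s) N.+ K N.* A₁ s) N.+ (2 N.+ n N.∸ s) N.* (K N.* A s N.+ K N.* A₂ s)) ∎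
    where
    open ≡-Reasoning
    vanish : 2 N.+ n N.< s → K N.* A s N.+ K N.* A₂ s ≡ 0
    vanish n+2<s = trans (cong₂ (λ x y → K N.* x N.+ K N.* y)
      (trans (sym (Ashift-0 (suc n) s)) (Ashift-above n 0 s (NP.≤-<-trans (NP.≤-reflexive (NP.+-identityʳ n))
                                                           (NP.<-trans (NP.n<1+n n) (NP.<-trans (NP.n<1+n (suc n)) n+2<s)))))
      (Ashift-above n 2 s (subst (N._< s) (NP.+-comm 2 n) n+2<s)))
      (cong₂ N._+_ (NP.*-zeroʳ K) (NP.*-zeroʳ K))

  count-identity : suc s N.* (K N.* A (suc s) N.+ K N.* A₁ s) N.+ (2 N.+ n N.∸ s) N.* (K N.* A s N.+ K N.* A₂ s)
                 ≡ 2 ^ suc n N.* Acount (suc (suc n)) s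
  count-identity = begin
    suc s N.* (K N.* A (suc s) N.+ K N.* A₁ s) N.+ (2 N.+ n N.∸ s) N.* (K N.* A s N.+ K N.* A₂ s)
      ≡⟨ factor K (suc s) (A (suc s)) (A₁ s) (2 N.+ n N.∸ s) (A s) (A₂ s) ⟩
    K N.* (suc s N.* A (suc s) N.+ suc s N.* A₁ s N.+ (2 N.+ n N.∸ s) N.* A s N.+ (2 N.+ n N.∸ s) N.* A₂ s)
      ≡⟨ cong (K N.*_) (sym recurrence) ⟩
    K N.* (2 N.* Acount (suc (suc n)) s)
      ≡⟨ reorder K (Acount (suc (suc n)) s) ⟩
    2 ^ suc n N.* Acount (suc (suc n)) s ∎
    where
    open ≡-Reasoning
    recurrence : 2 N.* Acount (suc (suc n)) s
               ≡ suc s N.* A (suc s) N.+ suc s N.* A₁ s N.+ (2 N.+ n N.∸ s) N.* A s N.+ (2 N.+ n N.∸ s) N.* A₂ s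
    recurrence = trans (Acount-rec n s)
      (cong (λ z → z N.* A z N.+ z N.* A₁ s N.+ (2 N.+ n N.∸ s) N.* A s N.+ (2 N.+ n N.∸ s) N.* A₂ s) (NP.+-comm s 1))
    factor : ∀ K a x y b u v → a N.* (K N.* x N.+ K N.* y) N.+ b N.* (K N.* u N.+ K N.* v)
                               ≡ K N.* (a N.* x N.+ a N.* y N.+ b N.* u N.+ b N.* v)
    factor = solve-∀
    reorder : ∀ K X → K N.* (2 N.* X) ≡ 2 N.* K N.* X
    reorder = solve-∀

  counted-rec : T n (counted n) s ≡ counted (suc n) s
  counted-rec = trans T-counted (cong +_ count-identity)

counted≡R : ∀ n s → counted n s ≡ R n s
counted≡R zero    zero    = refl
counted≡R zero    (suc s) = refl
counted≡R (suc n) s = begin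
  counted (suc n) s   ≡⟨ sym (counted-rec n s) ⟩
  T n (counted n) s   ≡⟨ T-cong n (counted≡R n) s ⟩
  T n (R n) s         ≡⟨ sym (R-rec n s) ⟩
  R (suc n) s         ∎
  where open ≡-Reasoning

-- Corollary 1.
corollary1 : (n s : ℕ) → 2 ≤ n → 1 ≤ s → s ≤ n →
    (+ (2 ^ n)) * (+ altEuler (suc n) s) ≡ rhsSum n s
corollary1 n s _ _ _ = begin
  + (2 ^ n) * + altEuler (suc n) s   ≡⟨ sym (ZP.pos-* (2 ^ n) (altEuler (suc n) s)) ⟩
  + (2 ^ n N.* altEuler (suc n) s)   ≡⟨ cong (λ a → + (2 ^ n N.* a)) (altEuler≡Acount (suc n) s) ⟩
  counted n s                        ≡⟨ counted≡R n s ⟩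
  R n s                              ≡⟨ sym (rhsSum≡R n s) ⟩
  rhsSum n s                         ∎
  where open ≡-Reasoning
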